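{- For all $n,k\in\mathbb{N}$, the poset $B_n[k]$ is rank-log concave and has the strong Sperner property (in particular it is rank-unimodal and Sperner).
   Context: $B_n$ is the Boolean algebra of all subsets of $\{1,\dots,n\}$ ordered by inclusion. For a poset $(P,\leq)$ and $k\in\mathbb{N}$, $P[k] = \{(x_1 \leq x_2 \leq \dotsb \leq x_k) \mid x_i \in P\}$ (multichains, repetitions allowed), ordered by $(x_1 \leq \dotsb \leq x_k) \leq_k (x'_1 \leq \dotsb \leq x'_k)$ iff $x_i \leq x'_i$ for all $i$; it is graded with rank $\rho(x_1\le\dots\le x_k)=\sum_i \rho(x_i)$, ranks starting at $0$ on minimal elements. For a graded poset $P$ of rank $n$ let $P_i=\{x\in P:\rho(x)=i\}$. $P$ is rank-log concave if $|P_i|^2\geq |P_{i-1}||P_{i+1}|$ for $i=1,\dots,n-1$. $P$ has the $m$-Sperner property if no union of $m$ antichains of $P$ has more elements than the union of the $m$ largest levels $P_i$; it has the strong Sperner property if it has the $m$-Sperner property for all $m\in\mathbb{N}$. -}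

module Defs where

open import Data.Nat using (ℕ; zero; suc; _+_; _*_; _≟_; _≤_)
open import Data.Nat.Properties using (≤-decTotalOrder)
open import Data.Bool using (Bool; true; false)
open import Data.Unit using (⊤; tt)
open import Data.Product using (_×_; _,_)
open import Data.Sum using (_⊎_)
open import Data.List using (List; []; _∷_; [_]; concatMap; map; length; filter; upTo; take; reverse)
open import Data.Nat.ListAction using (sum)
open import Data.List.Membership.Propositional using (_∈_)
open import Data.List.Sort.InsertionSort.Base ≤-decTotalOrder using (sort)
open import Data.Vec using (Vec; []; _∷_)
import Data.Vec as Vec
open import Data.Vec.Relation.Binary.Pointwise.Inductive using (Pointwise)
open import Data.Fin.Subset using (Subset; _⊆_; ∣_∣; inside; outside)
open import Data.Fin.Subset.Properties using (_⊆?_)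
open import Relation.Nullary using (Dec; yes; no; ¬_)
open import Relation.Nullary.Decidable using (_×-dec_)
open import Relation.Binary.PropositionalEquality using (_≡_; _≢_)

-- B_n : subsets of {1..n} (as Subset n = Vec Bool n), ordered by ⊆.
-- B_n[k] : multichains (x₁ ⊆ x₂ ⊆ … ⊆ x_k), represented as vectors of
-- subsets of length k satisfying IsMultichain.

Elem : ℕ → ℕ → Set
Elem n k = Vec (Subset n) k

IsMultichain : ∀ {n k} → Elem n k → Set
IsMultichain [] = ⊤
IsMultichain (x ∷ []) = ⊤
IsMultichain (x ∷ y ∷ xs) = x ⊆ y × IsMultichain (y ∷ xs)

isMultichain? : ∀ {n k} (v : Elem n k) → Dec (IsMultichain v)
isMultichain? [] = yes tt
isMultichain? (x ∷ []) = yes tt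
isMultichain? (x ∷ y ∷ xs) = (x ⊆? y) ×-dec isMultichain? (y ∷ xs)

_≤ₖ_ : ∀ {n k} → Elem n k → Elem n k → Set
x ≤ₖ y = Pointwise _⊆_ x y

Comparable : ∀ {n k} → Elem n k → Elem n k → Set
Comparable x y = x ≤ₖ y ⊎ y ≤ₖ x

rank : ∀ {n k} → Elem n k → ℕ
rank xs = Vec.sum (Vec.map ∣_∣ xs)

allSubsets : (n : ℕ) → List (Subset n)
allSubsets zero = [ [] ]
allSubsets (suc n) = concatMap (λ s → (outside ∷ s) ∷ (inside ∷ s) ∷ []) (allSubsets n)

allVecs : ∀ {A : Set} → List A → (k : ℕ) → List (Vec A k)
allVecs xs zero = [ [] ]
allVecs xs (suc k) = concatMap (λ v → map (λ x → x ∷ v) xs) (allVecs xs k)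

allMultichains : (n k : ℕ) → List (Elem n k)
allMultichains n k = filter isMultichain? (allVecs (allSubsets n) k)

levelSize : (n k i : ℕ) → ℕ
levelSize n k i = length (filter (λ x → rank x ≟ i) (allMultichains n k))

-- B_n[k] has rank n * k; level sizes for i = 0 … n*k
levelSizes : (n k : ℕ) → List ℕ
levelSizes n k = map (levelSize n k) (upTo (suc (n * k)))

sumLargestLevels : (n k m : ℕ) → ℕ
sumLargestLevels n k m = sum (take m (reverse (sort (levelSizes n k))))

RankLogConcave : ℕ → ℕ → Set
RankLogConcave n k = ∀ i → 1 ≤ i → suc i ≤ n * k →
  levelSize n k (suc i) * levelSize n k (i Data.Nat.∸ 1) ≤ levelSize n k i * levelSize n k i

IsAntichain : ∀ {n k} → List (Elem n k) → Set
IsAntichain {n} {k} A =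
  (∀ {x} → x ∈ A → IsMultichain x) ×
  (∀ {x y} → x ∈ A → y ∈ A → x ≢ y → ¬ Comparable x y)

InUnion : ∀ {n k} → List (List (Elem n k)) → Elem n k → Set
InUnion As x = Data.List.Relation.Unary.Any.Any (x ∈_) As
  where import Data.List.Relation.Unary.Any

MSperner : ℕ → ℕ → ℕ → Set
MSperner n k m =
  (As : List (List (Elem n k))) → length As ≡ m →
  (∀ {A} → A ∈ As → IsAntichain A) →
  (S : List (Elem n k)) → Data.List.Relation.Unary.Unique.Propositional.Unique S →
  (∀ {x} → x ∈ S → InUnion As x) →
  length S ≤ sumLargestLevels n k m
  where import Data.List.Relation.Unary.Unique.Propositional

StrongSperner : ℕ → ℕ → Set
StrongSperner n k = ∀ m → MSperner n k m

module Submission where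

-- B_n[k] is isomorphic to the product B_1[k]ⁿ of n chains with k+1
-- elements: splitting off the first coordinate of each subset in a
-- multichain yields a monotone bit column, i.e. an element of B_1[k].
-- Both halves of the theorem are proved by induction on n along this
-- product structure.
--   * Rank-log-concavity: the level sizes of B_{n+1}[k] are window sums of
--     length k+1 of the (shifted) level sizes of B_n[k]; window sums
--     preserve log-concavity in the strong PF₂ sense, which implies the
--     required inequalities.
--   * Strong Sperner: the product of a chain with a poset carrying a
--     symmetric chain decomposition carries one too ("hooks"), so B_n[k]
--     has a symmetric chain decomposition; counting a union of m
--     antichains chain by chain against the m middle levels bounds it by
--     the sum of m levels, which is at most the sum of the m largest.

open import Defs
open import Data.Nat using (ℕ)
open import Data.Product using (_×_; _,_)

module FiniteSums where

  open import Data.Nat using (zero; suc; _+_; _*_; _≤_; _<_; z≤n)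
  open import Data.Nat.Properties
  open import Data.List using (List; []; _∷_; map; applyUpTo)
  open import Data.Nat.ListAction using (sum)
  open import Data.List.Membership.Propositional using (_∈_)
  open import Data.List.Relation.Unary.Any using (here; there)
  open import Algebra.Properties.CommutativeSemigroup +-commutativeSemigroup using (interchange)
  open import Relation.Binary.PropositionalEquality
  open ≡-Reasoning

  Σ< : ℕ → (ℕ → ℕ) → ℕ
  Σ< zero f = 0
  Σ< (suc H) f = Σ< H f + f H

  Σ<-mono : ∀ H {f g : ℕ → ℕ} → (∀ h → h < H → f h ≤ g h) → Σ< H f ≤ Σ< H g
  Σ<-mono zero le = z≤n
  Σ<-mono (suc H) le = +-mono-≤ (Σ<-mono H (λ h h<H → le h (m≤n⇒m≤1+n h<H))) (le H ≤-refl)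

  Σ<-cong : ∀ H {f g : ℕ → ℕ} → (∀ h → h < H → f h ≡ g h) → Σ< H f ≡ Σ< H g
  Σ<-cong zero eq = refl
  Σ<-cong (suc H) eq = cong₂ _+_ (Σ<-cong H (λ h h<H → eq h (m≤n⇒m≤1+n h<H))) (eq H ≤-refl)

  Σ<-zero : ∀ H → Σ< H (λ _ → 0) ≡ 0
  Σ<-zero zero = refl
  Σ<-zero (suc H) = cong (_+ 0) (Σ<-zero H)

  Σ<-one : ∀ H → Σ< H (λ _ → 1) ≡ H
  Σ<-one zero = refl
  Σ<-one (suc H) = trans (cong (_+ 1) (Σ<-one H)) (+-comm H 1)

  Σ<-+ : ∀ H (f g : ℕ → ℕ) → Σ< H (λ h → f h + g h) ≡ Σ< H f + Σ< H g
  Σ<-+ zero f g = refl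
  Σ<-+ (suc H) f g =
    trans (cong (_+ (f H + g H)) (Σ<-+ H f g)) (interchange (Σ< H f) (Σ< H g) (f H) (g H))

  Σ<-split : ∀ a b f → Σ< (a + b) f ≡ Σ< a f + Σ< b (λ j → f (a + j))
  Σ<-split a zero f = trans (cong (λ w → Σ< w f) (+-identityʳ a)) (sym (+-identityʳ _))
  Σ<-split a (suc b) f =
    trans (cong (λ w → Σ< w f) (+-suc a b))
      (trans (cong (_+ f (a + b)) (Σ<-split a b f)) (+-assoc (Σ< a f) _ _))

  Σ<-mono-length : ∀ {H H'} f → H ≤ H' → Σ< H f ≤ Σ< H' f
  Σ<-mono-length {H} f H≤H' with m≤n⇒∃[o]m+o≡n H≤H'
  ... | d , refl = subst (Σ< H f ≤_) (sym (Σ<-split H d f)) (m≤m+n (Σ< H f) _)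

  Σ<-truncate : ∀ {M T} f → M ≤ T → (∀ s → M ≤ s → f s ≡ 0) → Σ< T f ≡ Σ< M f
  Σ<-truncate {M} f M≤T vanish with m≤n⇒∃[o]m+o≡n M≤T
  ... | d , refl = begin
    Σ< (M + d) f                        ≡⟨ Σ<-split M d f ⟩
    Σ< M f + Σ< d (λ j → f (M + j))     ≡⟨ cong (Σ< M f +_) (Σ<-cong d (λ j _ → vanish (M + j) (m≤m+n M j))) ⟩
    Σ< M f + Σ< d (λ _ → 0)             ≡⟨ cong (Σ< M f +_) (Σ<-zero d) ⟩
    Σ< M f + 0                          ≡⟨ +-identityʳ _ ⟩
    Σ< M f                              ∎

  Σ<-*ˡ : ∀ H c f → c * Σ< H f ≡ Σ< H (λ h → c * f h)
  Σ<-*ˡ zero c f = *-zeroʳ c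
  Σ<-*ˡ (suc H) c f = trans (*-distribˡ-+ c (Σ< H f) (f H)) (cong (_+ c * f H) (Σ<-*ˡ H c f))

  Σ<-*ʳ : ∀ H c f → Σ< H f * c ≡ Σ< H (λ h → f h * c)
  Σ<-*ʳ zero c f = refl
  Σ<-*ʳ (suc H) c f = trans (*-distribʳ-+ c (Σ< H f) (f H)) (cong (_+ f H * c) (Σ<-*ʳ H c f))

  sum-applyUpTo : ∀ (f g : ℕ → ℕ) K → sum (map f (applyUpTo g K)) ≡ Σ< K (λ j → f (g j))
  sum-applyUpTo f g zero = refl
  sum-applyUpTo f g (suc K) = begin
    f (g 0) + sum (map f (applyUpTo (λ j → g (suc j)) K)) ≡⟨ cong (f (g 0) +_) (sum-applyUpTo f (λ j → g (suc j)) K) ⟩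
    f (g 0) + Σ< K (λ j → f (g (suc j)))                  ≡⟨ sym (Σ<-shift K (λ j → f (g j))) ⟩
    Σ< (suc K) (λ j → f (g j))                           ∎
    where
    Σ<-shift : ∀ K h → Σ< (suc K) h ≡ h 0 + Σ< K (λ j → h (suc j))
    Σ<-shift zero h = +-comm 0 (h 0)
    Σ<-shift (suc K) h = trans (cong (_+ h (suc K)) (Σ<-shift K h)) (+-assoc (h 0) _ _)

  sum-Σ<-swap : ∀ {A : Set} (xs : List A) H (f : A → ℕ → ℕ) →
    sum (map (λ x → Σ< H (f x)) xs) ≡ Σ< H (λ h → sum (map (λ x → f x h) xs))
  sum-Σ<-swap [] H f = sym (Σ<-zero H)
  sum-Σ<-swap (x ∷ xs) H f =
    trans (cong (Σ< H (f x) +_) (sum-Σ<-swap xs H f)) (sym (Σ<-+ H (f x) _))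

  sum-map-cong : ∀ {A : Set} (xs : List A) {f g : A → ℕ} → (∀ {x} → x ∈ xs → f x ≡ g x) →
                 sum (map f xs) ≡ sum (map g xs)
  sum-map-cong [] _ = refl
  sum-map-cong (x ∷ xs) f≗g = cong₂ _+_ (f≗g (here refl)) (sum-map-cong xs (λ x∈ → f≗g (there x∈)))

  sum-map-mono : ∀ {A : Set} (xs : List A) {f g : A → ℕ} → (∀ {x} → x ∈ xs → f x ≤ g x) →
                 sum (map f xs) ≤ sum (map g xs)
  sum-map-mono [] _ = z≤n
  sum-map-mono (x ∷ xs) f≤g = +-mono-≤ (f≤g (here refl)) (sum-map-mono xs (λ x∈ → f≤g (there x∈)))

module Counting where

  open import Data.Nat using (suc; _+_; _≤_; z≤n; s≤s)
  open import Data.Nat.Properties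
  open import Algebra.Properties.CommutativeSemigroup +-commutativeSemigroup using (interchange)
  open import Data.List using (List; []; _∷_; _++_; [_]; length; filter; map)
  open import Data.List.Properties using (length-++; length-map)
  open import Data.Nat.ListAction using (sum)
  open import Data.List.Relation.Unary.All using (All; []; _∷_)
  import Data.List.Relation.Unary.All as All
  open import Data.List.Relation.Unary.AllPairs using ([]; _∷_)
  open import Data.List.Relation.Unary.Any using (here; there)
  open import Data.List.Relation.Unary.Unique.Propositional using (Unique)
  import Data.List.Relation.Unary.Unique.Propositional.Properties as Unique
  open import Data.List.Membership.Propositional using (_∈_)
  open import Data.List.Membership.Propositional.Properties using (∈-∃++; ∈-map⁻; ∈-filter⁺; ∈-filter⁻)
  open import Data.Product using (_,_; proj₂)
  open import Data.Empty using (⊥; ⊥-elim)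
  open import Relation.Nullary using (Dec; yes; no)
  open import Relation.Unary using (Decidable)
  open import Relation.Binary.Definitions using (DecidableEquality)
  open import Relation.Binary.PropositionalEquality using (_≡_; _≢_; refl; sym; trans; cong; cong₂; subst; module ≡-Reasoning)

  𝟙 : {P : Set} → Dec P → ℕ
  𝟙 (yes _) = 1
  𝟙 (no _) = 0

  𝟙-true : {P : Set} (P? : Dec P) → P → 𝟙 P? ≡ 1
  𝟙-true (yes _) _ = refl
  𝟙-true (no ¬p) p = ⊥-elim (¬p p)

  count : {A : Set} {P : A → Set} → Decidable P → List A → ℕ
  count P? xs = length (filter P? xs)

  count-∷ : {A : Set} {P : A → Set} (P? : Decidable P) → ∀ x xs →
            count P? (x ∷ xs) ≡ 𝟙 (P? x) + count P? xs
  count-∷ P? x xs with P? x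
  ... | yes _ = refl
  ... | no _ = refl

  sum-𝟙≡count : {A : Set} {P : A → Set} (P? : Decidable P) → ∀ xs →
                sum (map (λ x → 𝟙 (P? x)) xs) ≡ count P? xs
  sum-𝟙≡count P? [] = refl
  sum-𝟙≡count P? (x ∷ xs) = trans (cong (𝟙 (P? x) +_) (sum-𝟙≡count P? xs)) (sym (count-∷ P? x xs))

  no-members⇒length≡0 : {A : Set} (xs : List A) → (∀ {x} → x ∈ xs → ⊥) → length xs ≡ 0
  no-members⇒length≡0 [] _ = refl
  no-members⇒length≡0 (x ∷ xs) none = ⊥-elim (none (here refl))

  module _ {A : Set} where

    unique-length-≤ : (zs ys : List A) → Unique zs → (∀ {z} → z ∈ zs → z ∈ ys) → length zs ≤ length ys
    unique-length-≤ [] ys _ _ = z≤n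
    unique-length-≤ (z ∷ zs) ys (z∉zs ∷ uzs) zs⊆ys with ∈-∃++ (zs⊆ys (here refl))
    ... | ys₁ , ys₂ , refl = subst (suc (length zs) ≤_) (sym length-removed)
            (s≤s (unique-length-≤ zs (ys₁ ++ ys₂) uzs zs⊆ys₁ys₂))
      where
      remove : ∀ {w} ys₁ → w ∈ ys₁ ++ z ∷ ys₂ → w ≢ z → w ∈ ys₁ ++ ys₂
      remove [] (here refl) w≢z = ⊥-elim (w≢z refl)
      remove [] (there w∈) _ = w∈
      remove (y ∷ ys₁) (here refl) _ = here refl
      remove (y ∷ ys₁) (there w∈) w≢z = there (remove ys₁ w∈ w≢z)
      zs⊆ys₁ys₂ : ∀ {w} → w ∈ zs → w ∈ ys₁ ++ ys₂
      zs⊆ys₁ys₂ w∈ = remove ys₁ (zs⊆ys (there w∈)) (λ w≡z → All.lookup z∉zs w∈ (sym w≡z))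
      length-removed : length (ys₁ ++ z ∷ ys₂) ≡ suc (length (ys₁ ++ ys₂))
      length-removed = trans (length-++ ys₁)
        (trans (+-suc (length ys₁) (length ys₂)) (cong suc (sym (length-++ ys₁))))

  module _ {A B : Set} where

    injection-length-≤ : (f : A → B) (xs : List A) (ys : List B) → Unique xs →
                         (∀ {x} → x ∈ xs → f x ∈ ys) →
                         (∀ {x y} → x ∈ xs → y ∈ xs → f x ≡ f y → x ≡ y) →
                         length xs ≤ length ys
    injection-length-≤ f xs ys uxs into inj = subst (_≤ length ys) (length-map f xs)
      (unique-length-≤ (map f xs) ys (unique-map xs uxs (λ p q → inj p q)) image⊆ys)
      where
      image⊆ys : ∀ {w} → w ∈ map f xs → w ∈ ys
      image⊆ys w∈ with ∈-map⁻ f w∈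
      ... | x , x∈ , refl = into x∈
      unique-map : ∀ xs → Unique xs → (∀ {x y} → x ∈ xs → y ∈ xs → f x ≡ f y → x ≡ y) → Unique (map f xs)
      unique-map [] _ _ = []
      unique-map (x ∷ xs) (x∉xs ∷ uxs) inj' =
        All.tabulate fx∉ ∷ unique-map xs uxs (λ p q → inj' (there p) (there q))
        where
        fx∉ : ∀ {w} → w ∈ map f xs → f x ≢ w
        fx∉ w∈ fx≡w with ∈-map⁻ f w∈
        ... | y , y∈ , refl = All.lookup x∉xs y∈ (inj' (here refl) (there y∈) fx≡w)

  module Fibres {A K : Set} (_≟K_ : DecidableEquality K) (key : A → K) where

    fibre : K → List A → List A
    fibre c Y = filter (λ y → key y ≟K c) Y

    fibreSum : List K → List A → ℕ
    fibreSum cs Y = sum (map (λ c → length (fibre c Y)) cs)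

    fibreSum-∷ : ∀ cs y Y → fibreSum cs (y ∷ Y) ≡ count (key y ≟K_) cs + fibreSum cs Y
    fibreSum-∷ [] y Y = refl
    fibreSum-∷ (c ∷ cs) y Y = begin
      length (fibre c (y ∷ Y)) + fibreSum cs (y ∷ Y)
        ≡⟨ cong₂ _+_ (count-∷ (λ y → key y ≟K c) y Y) (fibreSum-∷ cs y Y) ⟩
      (𝟙 (key y ≟K c) + length (fibre c Y)) + (count (key y ≟K_) cs + fibreSum cs Y)
        ≡⟨ interchange (𝟙 (key y ≟K c)) _ _ _ ⟩
      (𝟙 (key y ≟K c) + count (key y ≟K_) cs) + (length (fibre c Y) + fibreSum cs Y)
        ≡⟨ cong (_+ fibreSum (c ∷ cs) Y) (sym (count-∷ (key y ≟K_) c cs)) ⟩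
      count (key y ≟K_) (c ∷ cs) + fibreSum (c ∷ cs) Y ∎
      where open ≡-Reasoning

    fibreSum≤length : ∀ cs Y → Unique cs → fibreSum cs Y ≤ length Y
    fibreSum≤length cs [] _ = ≤-reflexive (empty cs)
      where
      empty : ∀ cs → fibreSum cs [] ≡ 0
      empty [] = refl
      empty (c ∷ cs) = empty cs
    fibreSum≤length cs (y ∷ Y) ucs = subst (_≤ suc (length Y)) (sym (fibreSum-∷ cs y Y))
      (+-mono-≤ atMostOnce (fibreSum≤length cs Y ucs))
      where
      atMostOnce : count (key y ≟K_) cs ≤ 1
      atMostOnce = unique-length-≤ (filter (key y ≟K_) cs) [ key y ] (Unique.filter⁺ (key y ≟K_) ucs)
        (λ c∈ → here (sym (proj₂ (∈-filter⁻ (key y ≟K_) {xs = cs} c∈))))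

    length≤fibreSum : ∀ cs Y → (∀ {y} → y ∈ Y → key y ∈ cs) → length Y ≤ fibreSum cs Y
    length≤fibreSum cs [] _ = z≤n
    length≤fibreSum cs (y ∷ Y) keyed = subst (suc (length Y) ≤_) (sym (fibreSum-∷ cs y Y))
      (+-mono-≤ atLeastOnce (length≤fibreSum cs Y (λ y∈ → keyed (there y∈))))
      where
      atLeastOnce : 1 ≤ count (key y ≟K_) cs
      atLeastOnce with filter (key y ≟K_) cs | ∈-filter⁺ (key y ≟K_) (keyed (here refl)) refl
      ... | _ ∷ _ | _ = s≤s z≤n

-- Proof by the layer-cake formula
-- sum zs = Σ_h #{z ∈ zs : h < z}: level by level, the m largest entries
-- contain at least min(m, #{z : h < z}) entries above h.
module LargestEntries where

  open import Data.Nat using (zero; suc; _+_; _≤_; _≥_; _⊓_; z≤n; s≤s; _<?_)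
  open import Data.Nat.Properties
  open import Data.List using (List; []; _∷_; length; take; reverse)
  open import Data.List.Properties using (length-filter; unfold-reverse; filter-none)
  open import Data.Nat.ListAction using (sum)
  open import Data.List.Relation.Unary.All using (All; []; _∷_)
  import Data.List.Relation.Unary.All as All
  open import Data.List.Relation.Unary.AllPairs using (AllPairs; []; _∷_)
  import Data.List.Relation.Unary.AllPairs.Properties as AllPairs
  open import Data.List.Relation.Binary.Sublist.Propositional using (_⊆_)
  open import Data.List.Relation.Binary.Sublist.Propositional.Properties
    using (All-resp-⊆; filter⁺; length-mono-≤; take-⊆)
  open import Data.List.Relation.Binary.Permutation.Propositional using (_↭_; ↭-sym; ↭-trans)
  open import Data.List.Relation.Binary.Permutation.Propositional.Properties
    using (All-resp-↭; ↭-length; filter-↭; ↭-reverse)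
  open import Data.List.Relation.Unary.Sorted.TotalOrder.Properties using (Sorted⇒AllPairs)
  open import Data.List.Sort.InsertionSort.Base ≤-decTotalOrder using (sort)
  open import Data.List.Sort.InsertionSort.Properties ≤-decTotalOrder using (sort-↭; sort-↗)
  open import Relation.Nullary using (yes; no)
  open import Relation.Binary.PropositionalEquality
  open FiniteSums
  open Counting

  above : ℕ → List ℕ → ℕ
  above h = count (h <?_)

  Σ<-indicator : ∀ H z → Σ< H (λ h → 𝟙 (h <? z)) ≡ H ⊓ z
  Σ<-indicator zero z = refl
  Σ<-indicator (suc H) z with H <? z
  ... | yes H<z = trans (cong (_+ 1) (trans (Σ<-indicator H z) (m≤n⇒m⊓n≡m (<⇒≤ H<z))))
                    (trans (+-comm H 1) (sym (m≤n⇒m⊓n≡m H<z)))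
  ... | no H≮z = trans (+-identityʳ _)
                   (trans (trans (Σ<-indicator H z) (m≥n⇒m⊓n≡n z≤H)) (sym (m≥n⇒m⊓n≡n (m≤n⇒m≤1+n z≤H))))
    where z≤H = ≮⇒≥ H≮z

  layer-cake : ∀ H zs → All (_≤ H) zs → sum zs ≡ Σ< H (λ h → above h zs)
  layer-cake H [] _ = sym (Σ<-zero H)
  layer-cake H (z ∷ zs) (z≤H ∷ zs≤H) = begin
    z + sum zs
      ≡⟨ cong₂ _+_ (sym (trans (Σ<-indicator H z) (m≥n⇒m⊓n≡n z≤H))) (layer-cake H zs zs≤H) ⟩
    Σ< H (λ h → 𝟙 (h <? z)) + Σ< H (λ h → above h zs) ≡⟨ sym (Σ<-+ H _ _) ⟩
    Σ< H (λ h → 𝟙 (h <? z) + above h zs) ≡⟨ Σ<-cong H (λ h _ → sym (count-∷ (h <?_) z zs)) ⟩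
    Σ< H (λ h → above h (z ∷ zs)) ∎
    where open ≡-Reasoning

  entries≤sum : ∀ zs → All (_≤ sum zs) zs
  entries≤sum [] = []
  entries≤sum (z ∷ zs) = m≤m+n z (sum zs) ∷ All.map (λ p → ≤-trans p (m≤n+m (sum zs) z)) (entries≤sum zs)

  reverse-ascending : ∀ {zs} → AllPairs _≤_ zs → AllPairs _≥_ (reverse zs)
  reverse-ascending [] = []
  reverse-ascending {z ∷ zs} (z≤zs ∷ asc) rewrite unfold-reverse z zs =
    AllPairs.++⁺ (reverse-ascending asc) ([] ∷ [])
      (All.map (_∷ []) (All-resp-↭ (↭-sym (↭-reverse zs)) z≤zs))

  above-take : ∀ h m D → AllPairs _≥_ D → m ⊓ above h D ≤ above h (take m D)
  above-take h zero D _ = z≤n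
  above-take h (suc m) [] _ = z≤n
  above-take h (suc m) (d ∷ D) (d≥D ∷ desc)
    rewrite count-∷ (h <?_) d D | count-∷ (h <?_) d (take m D) with h <? d
  ... | yes _ = s≤s (above-take h m D desc)
  ... | no h≮d = subst (λ c → suc m ⊓ c ≤ above h (take m D)) (sym none-above) z≤n
    where
    none-above : above h D ≡ 0
    none-above = cong length (filter-none (h <?_) (All.map (λ d'≤d h<d' → h≮d (<-≤-trans h<d' d'≤d)) d≥D))

  sublist-sum≤largest : ∀ xs ys → ys ⊆ xs → sum ys ≤ sum (take (length ys) (reverse (sort xs)))
  sublist-sum≤largest xs ys ys⊆xs = begin
    sum ys                                  ≡⟨ layer-cake H ys (All-resp-⊆ ys⊆xs (entries≤sum xs)) ⟩
    Σ< H (λ h → above h ys)                 ≤⟨ Σ<-mono H (λ h _ → levelwise h) ⟩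
    Σ< H (λ h → above h (take m D))         ≡⟨ sym (layer-cake H (take m D) (All-resp-⊆ (take-⊆ m D) D≤H)) ⟩
    sum (take m D)                          ∎
    where
    open ≤-Reasoning
    H = sum xs
    D = reverse (sort xs)
    m = length ys
    D↭xs : D ↭ xs
    D↭xs = ↭-trans (↭-reverse (sort xs)) (sort-↭ xs)
    D≤H : All (_≤ H) D
    D≤H = All-resp-↭ (↭-sym D↭xs) (entries≤sum xs)
    descending : AllPairs _≥_ D
    descending = reverse-ascending (Sorted⇒AllPairs ≤-totalOrder (sort-↗ xs))
    levelwise : ∀ h → above h ys ≤ above h (take m D)
    levelwise h = ≤-trans (⊓-glb at-most-m at-most-in-D) (above-take h m D descending)
      where
      at-most-m : above h ys ≤ m
      at-most-m = length-filter (h <?_) ys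
      at-most-in-D : above h ys ≤ above h D
      at-most-in-D = ≤-trans (length-mono-≤ (filter⁺ (h <?_) (h <?_) (λ { refl p → p }) ys⊆xs))
                             (≤-reflexive (↭-length (filter-↭ (h <?_) (↭-sym D↭xs))))

  sum-take-mono : ∀ {m m'} zs → m ≤ m' → sum (take m zs) ≤ sum (take m' zs)
  sum-take-mono {zero} zs _ = z≤n
  sum-take-mono {suc m} {suc m'} [] _ = z≤n
  sum-take-mono {suc m} {suc m'} (z ∷ zs) (s≤s m≤m') = +-monoʳ-≤ z (sum-take-mono zs m≤m')

module Enumeration where

  open import Data.Nat using (zero; suc; _≟_)
  open import Data.Bool using (Bool; true; false)
  import Data.Bool as Bool
  open import Data.Vec using (Vec; []; _∷_)
  import Data.Vec as Vec
  import Data.Vec.Properties as Vec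
  open import Data.List using (List; []; _∷_; filter; map; concatMap)
  open import Data.List.Relation.Unary.All using (All; []; _∷_)
  open import Data.List.Relation.Unary.AllPairs using ([]; _∷_)
  open import Data.List.Relation.Unary.Unique.Propositional using (Unique)
  import Data.List.Relation.Unary.Unique.Propositional.Properties as Unique
  open import Data.List.Membership.Propositional using (_∈_)
  open import Data.List.Membership.Propositional.Properties
    using (∈-++⁻; ∈-++⁺ˡ; ∈-++⁺ʳ; ∈-map⁻; ∈-map⁺; ∈-filter⁺; ∈-filter⁻)
  open import Data.List.Relation.Unary.Any using (here; there)
  open import Data.Fin.Subset using (Subset; inside; outside)
  open import Data.Product using (_×_; _,_; proj₂)
  open import Data.Sum using (inj₁; inj₂)
  open import Data.Empty using (⊥)
  open import Relation.Nullary using (¬_)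
  open import Relation.Binary.Definitions using (DecidableEquality)
  open import Relation.Binary.PropositionalEquality using (_≡_; _≢_; refl; cong)

  _≟E_ : ∀ {n k} → DecidableEquality (Elem n k)
  _≟E_ = Vec.≡-dec (Vec.≡-dec Bool._≟_)

  conses : ∀ {A : Set} {k} → List A → List (Vec A k) → List (Vec A (suc k))
  conses as vs = concatMap (λ v → map (_∷ v) as) vs

  conses-unique : ∀ {A : Set} {k} (as : List A) (vs : List (Vec A k)) →
                  Unique as → Unique vs → Unique (conses as vs)
  conses-unique as [] _ _ = []
  conses-unique as (v ∷ vs) uas (v∉vs ∷ uvs) =
    Unique.++⁺ (Unique.map⁺ (λ { refl → refl }) uas) (conses-unique as vs uas uvs) disjoint
    where
    disjoint : ∀ {w} → ¬ (w ∈ map (_∷ v) as × w ∈ conses as vs)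
    disjoint (w∈ , w∈') with ∈-map⁻ (_∷ v) w∈
    ... | a , _ , refl = tail-differs vs v∉vs w∈'
      where
      tail-differs : ∀ vs → All (v ≢_) vs → (a ∷ v) ∈ conses as vs → ⊥
      tail-differs (v' ∷ vs) (v≢v' ∷ v∉vs) p with ∈-++⁻ (map (_∷ v') as) p
      ... | inj₁ q with ∈-map⁻ (_∷ v') q
      ...   | _ , _ , eq = v≢v' (cong Vec.tail eq)
      tail-differs (v' ∷ vs) (_ ∷ v∉vs) p | inj₂ q = tail-differs vs v∉vs q

  ∈-conses : ∀ {A : Set} {k} (as : List A) (vs : List (Vec A k)) {a v} →
             a ∈ as → v ∈ vs → (a ∷ v) ∈ conses as vs
  ∈-conses as (v ∷ vs) a∈ (here refl) = ∈-++⁺ˡ (∈-map⁺ (_∷ v) a∈)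
  ∈-conses as (v' ∷ vs) a∈ (there v∈) = ∈-++⁺ʳ (map (_∷ v') as) (∈-conses as vs a∈ v∈)

  allSubsets-unique : ∀ n → Unique (allSubsets n)
  allSubsets-unique zero = [] ∷ []
  allSubsets-unique (suc n) =
    conses-unique (outside ∷ inside ∷ []) (allSubsets n) (((λ ()) ∷ []) ∷ [] ∷ []) (allSubsets-unique n)

  ∈-allSubsets : ∀ {n} (s : Subset n) → s ∈ allSubsets n
  ∈-allSubsets {zero} [] = here refl
  ∈-allSubsets {suc n} (false ∷ s) = ∈-conses (outside ∷ inside ∷ []) (allSubsets n) (here refl) (∈-allSubsets s)
  ∈-allSubsets {suc n} (true ∷ s) = ∈-conses (outside ∷ inside ∷ []) (allSubsets n) (there (here refl)) (∈-allSubsets s)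

  allVecs-unique : ∀ {A : Set} (xs : List A) k → Unique xs → Unique (allVecs xs k)
  allVecs-unique xs zero _ = [] ∷ []
  allVecs-unique xs (suc k) uxs = conses-unique xs (allVecs xs k) uxs (allVecs-unique xs k uxs)

  ∈-allVecs : ∀ {A : Set} (xs : List A) {k} (v : Vec A k) → (∀ x → x ∈ xs) → v ∈ allVecs xs k
  ∈-allVecs xs [] _ = here refl
  ∈-allVecs xs {suc k} (x ∷ v) every = ∈-conses xs (allVecs xs k) (every x) (∈-allVecs xs v every)

  allMultichains-unique : ∀ n k → Unique (allMultichains n k)
  allMultichains-unique n k = Unique.filter⁺ isMultichain? (allVecs-unique (allSubsets n) k (allSubsets-unique n))

  ∈-allMultichains⁺ : ∀ {n k} {v : Elem n k} → IsMultichain v → v ∈ allMultichains n k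
  ∈-allMultichains⁺ {n} {k} {v} mc = ∈-filter⁺ isMultichain? (∈-allVecs (allSubsets n) v ∈-allSubsets) mc

  ∈-allMultichains⁻ : ∀ {n k} {v : Elem n k} → v ∈ allMultichains n k → IsMultichain v
  ∈-allMultichains⁻ {n} {k} v∈ = proj₂ (∈-filter⁻ isMultichain? {xs = allVecs (allSubsets n) k} v∈)

  level : (n k i : ℕ) → List (Elem n k)
  level n k i = filter (λ x → rank x ≟ i) (allMultichains n k)

  level-unique : ∀ n k i → Unique (level n k i)
  level-unique n k i = Unique.filter⁺ (λ x → rank x ≟ i) (allMultichains-unique n k)

  ∈-level⁺ : ∀ {n k i} {v : Elem n k} → IsMultichain v → rank v ≡ i → v ∈ level n k i
  ∈-level⁺ {i = i} mc rank≡i = ∈-filter⁺ (λ x → rank x ≟ i) (∈-allMultichains⁺ mc) rank≡i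

  ∈-level⁻ : ∀ {n k i} {v : Elem n k} → v ∈ level n k i → IsMultichain v × rank v ≡ i
  ∈-level⁻ {n} {k} {i} v∈ with ∈-filter⁻ (λ x → rank x ≟ i) {xs = allMultichains n k} v∈
  ... | v∈' , rank≡i = ∈-allMultichains⁻ v∈' , rank≡i

  rank-B₀ : ∀ {k} (v : Elem 0 k) → rank v ≡ 0
  rank-B₀ [] = refl
  rank-B₀ ([] ∷ v) = rank-B₀ v


-- An element of B_{n+1}[k] is a
-- column  (b₁ ≤ … ≤ b_k)  of bits, i.e. an element of the chain B_1[k]
-- with k+1 elements, together with an element of B_n[k]; this identifies
-- B_{n+1}[k] with the product B_n[k] × B_1[k].
module Columns where

  open import Data.Nat using (zero; suc; _+_; _∸_; _≤_; _<_; s≤s)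
  open import Data.Nat.Properties using (+-suc; m≤n+m; m≤m+n; +-commutativeSemigroup; m∸[m∸n]≡n; +-∸-assoc; m+n∸m≡n)
  open import Algebra.Properties.CommutativeSemigroup +-commutativeSemigroup using (x∙yz≈y∙xz)
  open import Data.Bool using (Bool; true; false; f≤t; b≤b)
  import Data.Bool as Bool
  open import Data.Vec using (Vec; []; _∷_)
  import Data.Vec as Vec
  open import Data.Vec.Relation.Binary.Pointwise.Inductive as Pointwise using (Pointwise; []; _∷_)
  open import Data.Fin.Subset using (Subset; _⊆_; ∣_∣)
  open import Data.Fin.Subset.Properties using (out⊆; in⊆in; drop-∷-⊆)
  open import Data.Product using (_×_; _,_)
  open import Data.Unit using (⊤; tt)
  open import Relation.Binary.PropositionalEquality using (_≡_; refl; sym; trans; cong; subst)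

  column : ∀ {n k} → Elem (suc n) k → Vec Bool k
  column = Vec.map Vec.head

  rest : ∀ {n k} → Elem (suc n) k → Elem n k
  rest = Vec.map Vec.tail

  attach : ∀ {n k} → Vec Bool k → Elem n k → Elem (suc n) k
  attach [] [] = []
  attach (b ∷ bs) (s ∷ t) = (b ∷ s) ∷ attach bs t

  attach-split : ∀ {n k} (v : Elem (suc n) k) → attach (column v) (rest v) ≡ v
  attach-split [] = refl
  attach-split ((b ∷ s) ∷ v) = cong ((b ∷ s) ∷_) (attach-split v)

  column-attach : ∀ {n k} (bs : Vec Bool k) (t : Elem n k) → column (attach bs t) ≡ bs
  column-attach [] [] = refl
  column-attach (b ∷ bs) (s ∷ t) = cong (b ∷_) (column-attach bs t)

  rest-attach : ∀ {n k} (bs : Vec Bool k) (t : Elem n k) → rest (attach bs t) ≡ t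
  rest-attach [] [] = refl
  rest-attach (b ∷ bs) (s ∷ t) = cong (s ∷_) (rest-attach bs t)

  trues : ∀ {k} → Vec Bool k → ℕ
  trues [] = 0
  trues (true ∷ bs) = suc (trues bs)
  trues (false ∷ bs) = trues bs

  falses : ∀ {k} → Vec Bool k → ℕ
  falses [] = 0
  falses (true ∷ bs) = falses bs
  falses (false ∷ bs) = suc (falses bs)

  trues+falses : ∀ {k} (bs : Vec Bool k) → trues bs + falses bs ≡ k
  trues+falses [] = refl
  trues+falses (true ∷ bs) = cong suc (trues+falses bs)
  trues+falses (false ∷ bs) = trans (+-suc (trues bs) (falses bs)) (cong suc (trues+falses bs))

  falses≤ : ∀ {k} (bs : Vec Bool k) → falses bs ≤ k
  falses≤ bs = subst (falses bs ≤_) (trues+falses bs) (m≤n+m (falses bs) (trues bs))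

  rank-attach : ∀ {n k} (bs : Vec Bool k) (t : Elem n k) → rank (attach bs t) ≡ trues bs + rank t
  rank-attach [] [] = refl
  rank-attach (true ∷ bs) (s ∷ t) = cong suc (trans (cong (∣ s ∣ +_) (rank-attach bs t)) (x∙yz≈y∙xz ∣ s ∣ (trues bs) (rank t)))
  rank-attach (false ∷ bs) (s ∷ t) = trans (cong (∣ s ∣ +_) (rank-attach bs t)) (x∙yz≈y∙xz ∣ s ∣ (trues bs) (rank t))

  Monotone : ∀ {k} → Vec Bool k → Set
  Monotone [] = ⊤
  Monotone (b ∷ []) = ⊤
  Monotone (b ∷ b' ∷ bs) = b Bool.≤ b' × Monotone (b' ∷ bs)

  ∷-⊆-∷ : ∀ {n b b'} {s s' : Subset n} → b Bool.≤ b' → s ⊆ s' → (b ∷ s) ⊆ (b' ∷ s')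
  ∷-⊆-∷ f≤t s⊆s' = out⊆ s⊆s'
  ∷-⊆-∷ {b = false} b≤b s⊆s' = out⊆ s⊆s'
  ∷-⊆-∷ {b = true} b≤b s⊆s' = in⊆in s⊆s'

  ∷-⊆-∷⁻ : ∀ {n} b b' {s s' : Subset n} → (b ∷ s) ⊆ (b' ∷ s') → b Bool.≤ b' × s ⊆ s'
  ∷-⊆-∷⁻ false false sub = b≤b , drop-∷-⊆ sub
  ∷-⊆-∷⁻ false true sub = f≤t , drop-∷-⊆ sub
  ∷-⊆-∷⁻ true true sub = b≤b , drop-∷-⊆ sub
  ∷-⊆-∷⁻ true false sub with sub Vec.here
  ... | ()

  multichain-attach⁻ : ∀ {n k} (bs : Vec Bool k) (t : Elem n k) →
                       IsMultichain (attach bs t) → Monotone bs × IsMultichain t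
  multichain-attach⁻ [] [] _ = tt , tt
  multichain-attach⁻ (b ∷ []) (s ∷ []) _ = tt , tt
  multichain-attach⁻ (b ∷ b' ∷ bs) (s ∷ s' ∷ t) (sub , mc)
    with ∷-⊆-∷⁻ b b' sub | multichain-attach⁻ (b' ∷ bs) (s' ∷ t) mc
  ... | b≤b' , s⊆s' | mono , mct = (b≤b' , mono) , (s⊆s' , mct)

  multichain-attach⁺ : ∀ {n k} (bs : Vec Bool k) (t : Elem n k) →
                       Monotone bs → IsMultichain t → IsMultichain (attach bs t)
  multichain-attach⁺ [] [] _ _ = tt
  multichain-attach⁺ (b ∷ []) (s ∷ []) _ _ = tt
  multichain-attach⁺ (b ∷ b' ∷ bs) (s ∷ s' ∷ t) (b≤b' , mono) (s⊆s' , mct) =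
    ∷-⊆-∷ b≤b' s⊆s' , multichain-attach⁺ (b' ∷ bs) (s' ∷ t) mono mct

  attach-≤ : ∀ {n k} {bs bs' : Vec Bool k} {t t' : Elem n k} →
             Pointwise Bool._≤_ bs bs' → t ≤ₖ t' → attach bs t ≤ₖ attach bs' t'
  attach-≤ {bs = []} {[]} {[]} {[]} [] [] = []
  attach-≤ {bs = _ ∷ _} {_ ∷ _} {_ ∷ _} {_ ∷ _} (b≤b' ∷ bs≤bs') (s⊆s' ∷ t≤t') =
    ∷-⊆-∷ b≤b' s⊆s' ∷ attach-≤ bs≤bs' t≤t'

  allTrue : ∀ k → Vec Bool k
  allTrue k = Vec.replicate k true

  stepColumn : ℕ → (k : ℕ) → Vec Bool k
  stepColumn zero k = allTrue k
  stepColumn (suc z) zero = []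
  stepColumn (suc z) (suc k) = false ∷ stepColumn z k

  falses-allTrue : ∀ k → falses (allTrue k) ≡ 0
  falses-allTrue zero = refl
  falses-allTrue (suc k) = falses-allTrue k

  trues-allTrue : ∀ k → trues (allTrue k) ≡ k
  trues-allTrue zero = refl
  trues-allTrue (suc k) = cong suc (trues-allTrue k)

  falses-stepColumn : ∀ {z k} → z ≤ k → falses (stepColumn z k) ≡ z
  falses-stepColumn {zero} {k} _ = falses-allTrue k
  falses-stepColumn {suc z} {suc k} (s≤s z≤k) = cong suc (falses-stepColumn z≤k)

  trues-stepColumn : ∀ z k → trues (stepColumn z k) ≡ k ∸ z
  trues-stepColumn zero k = trues-allTrue k
  trues-stepColumn (suc z) zero = refl
  trues-stepColumn (suc z) (suc k) = trues-stepColumn z k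

  allTrue-after-true : ∀ {k} (bs : Vec Bool k) → Monotone (true ∷ bs) → bs ≡ allTrue k
  allTrue-after-true [] _ = refl
  allTrue-after-true (true ∷ bs) (_ , mono) = cong (true ∷_) (allTrue-after-true bs mono)
  allTrue-after-true (false ∷ bs) (() , _)

  monotone⇒step : ∀ {k} (bs : Vec Bool k) → Monotone bs → bs ≡ stepColumn (falses bs) k
  monotone⇒step [] _ = refl
  monotone⇒step {suc k} (true ∷ bs) mono rewrite allTrue-after-true bs mono | falses-allTrue k = refl
  monotone⇒step (false ∷ []) _ = refl
  monotone⇒step (false ∷ b ∷ bs) (_ , mono) = cong (false ∷_) (monotone⇒step (b ∷ bs) mono)

  stepColumn-monotone : ∀ z k → Monotone (stepColumn z k)
  stepColumn-monotone zero zero = tt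
  stepColumn-monotone zero (suc zero) = tt
  stepColumn-monotone zero (suc (suc k)) = b≤b , stepColumn-monotone zero (suc k)
  stepColumn-monotone (suc z) zero = tt
  stepColumn-monotone (suc zero) (suc zero) = tt
  stepColumn-monotone (suc zero) (suc (suc k)) = f≤t , stepColumn-monotone zero (suc k)
  stepColumn-monotone (suc (suc z)) (suc zero) = tt
  stepColumn-monotone (suc (suc z)) (suc (suc k)) = b≤b , stepColumn-monotone (suc z) (suc k)

  stepColumn-≤ : ∀ z k → Pointwise Bool._≤_ (stepColumn (suc z) k) (stepColumn z k)
  stepColumn-≤ zero zero = []
  stepColumn-≤ (suc z) zero = []
  stepColumn-≤ zero (suc k) = f≤t ∷ below-allTrue (stepColumn zero k)
    where
    below-allTrue : ∀ {k} (bs : Vec Bool k) → Pointwise Bool._≤_ bs (allTrue k)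
    below-allTrue [] = []
    below-allTrue (false ∷ bs) = f≤t ∷ below-allTrue bs
    below-allTrue (true ∷ bs) = b≤b ∷ below-allTrue bs
  stepColumn-≤ (suc z) (suc k) = b≤b ∷ stepColumn-≤ z k

  trues≤ : ∀ {k} (bs : Vec Bool k) → trues bs ≤ k
  trues≤ bs = subst (trues bs ≤_) (trues+falses bs) (m≤m+n (trues bs) (falses bs))

  topColumn : ℕ → (k : ℕ) → Vec Bool k
  topColumn t k = stepColumn (k ∸ t) k

  trues-topColumn : ∀ {t k} → t ≤ k → trues (topColumn t k) ≡ t
  trues-topColumn {t} {k} t≤k = trans (trues-stepColumn (k ∸ t) k) (m∸[m∸n]≡n t≤k)

  topColumn-monotone : ∀ t k → Monotone (topColumn t k)
  topColumn-monotone t k = stepColumn-monotone (k ∸ t) k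

  topColumn-≤ : ∀ {t k} → t < k → Pointwise Bool._≤_ (topColumn t k) (topColumn (suc t) k)
  topColumn-≤ {t} {k} t<k =
    subst (λ z → Pointwise Bool._≤_ (stepColumn z k) (topColumn (suc t) k)) (sym (+-∸-assoc 1 t<k))
      (stepColumn-≤ (k ∸ suc t) k)

  monotone⇒top : ∀ {k} (bs : Vec Bool k) → Monotone bs → bs ≡ topColumn (trues bs) k
  monotone⇒top {k} bs mono = trans (monotone⇒step bs mono) (cong (λ z → stepColumn z k) falses≡)
    where
    falses≡ : falses bs ≡ k ∸ trues bs
    falses≡ = trans (sym (m+n∸m≡n (trues bs) (falses bs))) (cong (_∸ trues bs) (trues+falses bs))

  ≤ₖ-refl : ∀ {n k} {v : Elem n k} → v ≤ₖ v
  ≤ₖ-refl = Pointwise.refl (λ {s} {x} x∈ → x∈)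

  ≤ₖ-trans : ∀ {n k} {u v w : Elem n k} → u ≤ₖ v → v ≤ₖ w → u ≤ₖ w
  ≤ₖ-trans = Pointwise.trans (λ u⊆v v⊆w {x} x∈ → v⊆w (u⊆v x∈))

-- Shifting a sequence and
-- summing it over windows of a fixed length (= convolving it with the
-- all-ones sequence) both preserve this property.
module LogConcavity where

  open import Data.Nat using (zero; suc; _+_; _*_; _∸_; _≤_; _<_; z≤n; _≤?_; _<?_)
  open import Data.Nat.Properties
  open import Data.Product using (_×_; _,_)
  open import Data.Sum using (_⊎_; inj₁; inj₂)
  open import Data.Empty using (⊥-elim)
  open import Relation.Nullary using (yes; no; ¬_)
  open import Relation.Nullary.Decidable using (_×-dec_)
  open import Relation.Binary.PropositionalEquality
  open import Data.Nat.Tactic.RingSolver using (solve-∀)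
  open FiniteSums
  open Counting using (𝟙)

  PF₂ : (ℕ → ℕ) → Set
  PF₂ a = ∀ x y → x < y → a x * a (suc y) ≤ a (suc x) * a y

  PF₂-cong : ∀ {a b} → (∀ x → a x ≡ b x) → PF₂ a → PF₂ b
  PF₂-cong {a} {b} a≗b pf x y x<y =
    subst₂ _≤_ (cong₂ _*_ (a≗b x) (a≗b (suc y))) (cong₂ _*_ (a≗b (suc x)) (a≗b y)) (pf x y x<y)

  shift : ℕ → (ℕ → ℕ) → ℕ → ℕ
  shift k a y with k ≤? y
  ... | yes _ = a (y ∸ k)
  ... | no _ = 0

  shift-≥ : ∀ k a y → k ≤ y → shift k a y ≡ a (y ∸ k)
  shift-≥ k a y k≤y with k ≤? y
  ... | yes _ = refl
  ... | no k≰y = ⊥-elim (k≰y k≤y)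

  PF₂-shift : ∀ k a → PF₂ a → PF₂ (shift k a)
  PF₂-shift k a pf x y x<y with k ≤? x
  ... | no _ = z≤n
  ... | yes k≤x = subst₂ _≤_ (sym (cong (a (x ∸ k) *_) (shift-≥-suc y k≤y)))
                              (sym (cong₂ _*_ (shift-≥-suc x k≤x) (shift-≥ k a y k≤y)))
                              (pf (x ∸ k) (y ∸ k) (subst (_≤ y ∸ k) (+-∸-assoc 1 k≤x) (∸-monoˡ-≤ k x<y)))
    where
    k≤y = ≤-trans k≤x (<⇒≤ x<y)
    shift-≥-suc : ∀ z → k ≤ z → shift k a (suc z) ≡ a (suc (z ∸ k))
    shift-≥-suc z k≤z = trans (shift-≥ k a (suc z) (m≤n⇒m≤1+n k≤z)) (cong a (+-∸-assoc 1 k≤z))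

  rearrangement : ∀ a₁ a₂ b₁ b₂ → a₂ ≤ a₁ → b₂ ≤ b₁ → a₁ * b₂ + a₂ * b₁ ≤ a₁ * b₁ + a₂ * b₂
  rearrangement a₁ a₂ b₁ b₂ a₂≤a₁ b₂≤b₁ with m≤n⇒∃[o]m+o≡n a₂≤a₁ | m≤n⇒∃[o]m+o≡n b₂≤b₁
  ... | d , refl | e , refl = subst (((a₂ + d) * b₂ + a₂ * (b₂ + e)) ≤_) (expand a₂ d b₂ e) (m≤m+n _ (d * e))
    where
    expand : ∀ a d b e → (a + d) * b + a * (b + e) + d * e ≡ (a + d) * (b + e) + a * b
    expand = solve-∀

  Σ²< : ℕ → (ℕ → ℕ → ℕ) → ℕ
  Σ²< T h = Σ< T (λ s → Σ< T (λ t → h s t))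

  Σ<-product : ∀ T f g → Σ< T f * Σ< T g ≡ Σ²< T (λ s t → f s * g t)
  Σ<-product T f g = trans (Σ<-*ʳ T (Σ< T g) f) (Σ<-cong T (λ s _ → Σ<-*ˡ T (f s) g))

  Σ²<-suc : ∀ T h → Σ²< (suc T) h ≡ (Σ²< T h + Σ< T (λ s → h s T + h T s)) + h T T
  Σ²<-suc T h = begin
    Σ< T (λ s → Σ< T (h s) + h s T) + (Σ< T (h T) + h T T)
      ≡⟨ cong (_+ (Σ< T (h T) + h T T)) (Σ<-+ T (λ s → Σ< T (h s)) (λ s → h s T)) ⟩
    (Σ²< T h + Σ< T (λ s → h s T)) + (Σ< T (h T) + h T T)
      ≡⟨ sym (+-assoc (Σ²< T h + Σ< T (λ s → h s T)) (Σ< T (h T)) (h T T)) ⟩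
    ((Σ²< T h + Σ< T (λ s → h s T)) + Σ< T (h T)) + h T T
      ≡⟨ cong (_+ h T T) (trans (+-assoc (Σ²< T h) _ _) (cong (Σ²< T h +_) (sym (Σ<-+ T (λ s → h s T) (h T))))) ⟩
    (Σ²< T h + Σ< T (λ s → h s T + h T s)) + h T T ∎
    where open ≡-Reasoning

  Σ²<-rearrangement : ∀ T (F G : ℕ → ℕ → ℕ) →
    (∀ s t → s < t → F t s ≤ F s t) → (∀ s t → s < t → G t s ≤ G s t) →
    Σ²< T (λ s t → F s t * G t s) ≤ Σ²< T (λ s t → F s t * G s t)
  Σ²<-rearrangement zero F G _ _ = z≤n
  Σ²<-rearrangement (suc T) F G F↓ G↓
    rewrite Σ²<-suc T (λ s t → F s t * G t s) | Σ²<-suc T (λ s t → F s t * G s t) =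
    +-mono-≤ (+-mono-≤ (Σ²<-rearrangement T F G F↓ G↓)
                        (Σ<-mono T (λ s s<T → rearrangement (F s T) (F T s) (G s T) (G T s) (F↓ s T s<T) (G↓ s T s<T))))
             ≤-refl

  module Window (K : ℕ) where

    inWindow : ℕ → ℕ → ℕ
    inWindow x s = 𝟙 (x ≤? s ×-dec s <? x + K)

    inWindow-view : ∀ x s → (inWindow x s ≡ 1 × x ≤ s × s < x + K) ⊎ inWindow x s ≡ 0
    inWindow-view x s with x ≤? s ×-dec s <? x + K
    ... | yes (x≤s , s<) = inj₁ (refl , x≤s , s<)
    ... | no _ = inj₂ refl

    inWindow-in : ∀ {x s} → x ≤ s → s < x + K → inWindow x s ≡ 1
    inWindow-in {x} {s} x≤s s< with x ≤? s ×-dec s <? x + K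
    ... | yes _ = refl
    ... | no out = ⊥-elim (out (x≤s , s<))

    inWindow-out : ∀ {x s} → ¬ (x ≤ s × s < x + K) → inWindow x s ≡ 0
    inWindow-out {x} {s} out with x ≤? s ×-dec s <? x + K
    ... | yes in' = ⊥-elim (out in')
    ... | no _ = refl

    window-sum : ∀ (f : ℕ → ℕ) x T → x + K ≤ T → Σ< K (λ j → f (x + j)) ≡ Σ< T (λ s → inWindow x s * f s)
    window-sum f x T x+K≤T = sym (begin
      Σ< T (λ s → inWindow x s * f s)
        ≡⟨ Σ<-truncate _ x+K≤T (λ s x+K≤s → cong (_* f s) (inWindow-out (λ (_ , s<) → <-irrefl refl (<-≤-trans s< x+K≤s)))) ⟩
      Σ< (x + K) (λ s → inWindow x s * f s) ≡⟨ Σ<-split x K _ ⟩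
      Σ< x (λ s → inWindow x s * f s) + Σ< K (λ j → inWindow x (x + j) * f (x + j))
        ≡⟨ cong₂ _+_ (trans (Σ<-cong x (λ s s<x → cong (_* f s) (inWindow-out (λ (x≤s , _) → <-irrefl refl (<-≤-trans s<x x≤s))))) (Σ<-zero x))
                     (Σ<-cong K (λ j j<K → trans (cong (_* f (x + j)) (inWindow-in (m≤m+n x j) (+-monoʳ-< x j<K))) (+-identityʳ _))) ⟩
      Σ< K (λ j → f (x + j)) ∎)
      where open ≡-Reasoning

    inWindow-exchange : ∀ {x y} → x ≤ y → ∀ s t → s < t → inWindow x t * inWindow y s ≤ inWindow x s * inWindow y t
    inWindow-exchange {x} {y} x≤y s t s<t with inWindow-view x t | inWindow-view y s
    ... | inj₂ zero-t | _ rewrite zero-t = z≤n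
    ... | inj₁ _ | inj₂ zero-s rewrite zero-s | *-zeroʳ (inWindow x t) = z≤n
    ... | inj₁ (one-t , x≤t , t<) | inj₁ (one-s , y≤s , s<) rewrite one-t | one-s
          | inWindow-in {x} {s} (≤-trans x≤y y≤s) (<-trans s<t t<)
          | inWindow-in {y} {t} (≤-trans y≤s (<⇒≤ s<t)) (<-≤-trans t< (+-monoˡ-≤ K x≤y)) = ≤-refl

    -- window sums preserve PF₂: expand both products as double sums over
    -- [0,T)² and compare them entrywise by rearrangement
    PF₂-window : ∀ b → PF₂ b → PF₂ (λ x → Σ< K (λ j → b (x + j)))
    PF₂-window b pf x y x<y = subst₂ _≤_ (sym crosswise) (sym straight)
      (Σ²<-rearrangement T F G (λ s t s<t → inWindow-exchange (<⇒≤ x<y) s t s<t)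
                               (λ s t s<t → subst (_≤ G s t) (*-comm (b s) (b (suc t))) (pf s t s<t)))
      where
      T = suc y + K
      F : ℕ → ℕ → ℕ
      F s t = inWindow x s * inWindow y t
      G : ℕ → ℕ → ℕ
      G s t = b (suc s) * b t
      x+K≤T : x + K ≤ T
      x+K≤T = +-monoˡ-≤ K (m≤n⇒m≤1+n (<⇒≤ x<y))
      y+K≤T : y + K ≤ T
      y+K≤T = +-monoˡ-≤ K (n≤1+n y)
      regroup₁ : ∀ a b c d → (a * b) * (c * d) ≡ (a * c) * (d * b)
      regroup₁ = solve-∀
      regroup₂ : ∀ a b c d → (a * b) * (c * d) ≡ (a * c) * (b * d)
      regroup₂ = solve-∀
      crosswise : Σ< K (λ j → b (x + j)) * Σ< K (λ j → b (suc y + j)) ≡ Σ²< T (λ s t → F s t * G t s)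
      crosswise = trans (cong₂ _*_ (window-sum b x T x+K≤T) (window-sum (λ s → b (suc s)) y T y+K≤T))
        (trans (Σ<-product T _ _) (Σ<-cong T (λ s _ → Σ<-cong T (λ t _ →
          regroup₁ (inWindow x s) (b s) (inWindow y t) (b (suc t))))))
      straight : Σ< K (λ j → b (suc x + j)) * Σ< K (λ j → b (y + j)) ≡ Σ²< T (λ s t → F s t * G s t)
      straight = trans (cong₂ _*_ (window-sum (λ s → b (suc s)) x T x+K≤T) (window-sum b y T y+K≤T))
        (trans (Σ<-product T _ _) (Σ<-cong T (λ s _ → Σ<-cong T (λ t _ →
          regroup₂ (inWindow x s) (b (suc s)) (inWindow y t) (b t)))))

-- Level sizes of B_{n+1}[k] ≅ B_n[k] × B_1[k]: sorting the rank-i elements by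
-- the number z of falses of their column gives
--   |B_{n+1}[k]_i| = Σ_{z ≤ k} |B_n[k]_{i+z-k}|,
-- a window sum of the level sizes of B_n[k] shifted right by k.
module LevelRecurrence where

  open import Data.Nat using (suc; _+_; _∸_; _≤_; s≤s; _≟_; _≤?_)
  open import Data.Nat.Properties
  open import Data.List using (List; length; map; upTo)
  open import Data.List.Membership.Propositional using (_∈_)
  open import Data.List.Membership.Propositional.Properties using (∈-filter⁺; ∈-filter⁻; ∈-upTo⁺; ∈-upTo⁻)
  import Data.List.Relation.Unary.Unique.Propositional.Properties as Unique
  open import Data.Product using (_×_; _,_; proj₁; proj₂)
  open import Relation.Nullary using (yes; no)
  open import Data.Empty using (⊥)
  open import Data.Nat.ListAction using (sum)
  open import Relation.Binary.PropositionalEquality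
  open FiniteSums
  open Counting
  open Enumeration
  open Columns
  open LogConcavity using (shift)

  rank-of-rest : ∀ z k i → z ≤ k → k ≤ i + z → (k ∸ z) + (i + z ∸ k) ≡ i
  rank-of-rest z k i z≤k k≤i+z = begin
    (k ∸ z) + (i + z ∸ k) ≡⟨ sym (+-∸-assoc (k ∸ z) k≤i+z) ⟩
    (k ∸ z) + (i + z) ∸ k ≡⟨ cong (_∸ k) (trans (cong ((k ∸ z) +_) (+-comm i z)) (sym (+-assoc (k ∸ z) z i))) ⟩
    (k ∸ z) + z + i ∸ k   ≡⟨ cong (λ w → w + i ∸ k) (m∸n+n≡m z≤k) ⟩
    k + i ∸ k             ≡⟨ m+n∸m≡n k i ⟩
    i                     ∎
    where open ≡-Reasoning

  module _ (n k i : ℕ) where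

    open Fibres _≟_ (λ (v : Elem (suc n) k) → falses (column v))

    top : List (Elem (suc n) k)
    top = level (suc n) k i

    fibre-split : ∀ {z y} → y ∈ fibre z top →
                  column y ≡ stepColumn z k × IsMultichain (rest y) × (k ∸ z) + rank (rest y) ≡ i
    fibre-split {z} {y} y∈ with ∈-filter⁻ (λ v → falses (column v) ≟ z) {xs = top} y∈
    ... | y∈top , falses≡z with ∈-level⁻ y∈top
    ...   | mc , rank≡i with multichain-attach⁻ (column y) (rest y) (subst IsMultichain (sym (attach-split y)) mc)
    ...     | mono , mc-rest = column≡ , mc-rest , rank-split
      where
      column≡ : column y ≡ stepColumn z k
      column≡ = trans (monotone⇒step (column y) mono) (cong (λ w → stepColumn w k) falses≡z)
      rank-split : (k ∸ z) + rank (rest y) ≡ i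
      rank-split = begin
        (k ∸ z) + rank (rest y)             ≡⟨ cong (_+ rank (rest y)) (sym (trans (cong trues column≡) (trues-stepColumn z k))) ⟩
        trues (column y) + rank (rest y)    ≡⟨ sym (rank-attach (column y) (rest y)) ⟩
        rank (attach (column y) (rest y))   ≡⟨ cong rank (attach-split y) ⟩
        rank y                              ≡⟨ rank≡i ⟩
        i                                   ∎
        where open ≡-Reasoning

    fibre-size : ∀ z → z ≤ k → length (fibre z top) ≡ shift k (levelSize n k) (i + z)
    fibre-size z z≤k with k ≤? i + z
    ... | no k≰i+z = no-members⇒length≡0 (fibre z top) impossible
      where
      impossible : ∀ {y} → y ∈ fibre z top → ⊥
      impossible y∈ = k≰i+z (subst (_≤ i + z) (m∸n+n≡m z≤k)
        (+-monoˡ-≤ z (subst (k ∸ z ≤_) (proj₂ (proj₂ (fibre-split y∈))) (m≤m+n (k ∸ z) _))))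
    ... | yes k≤i+z = ≤-antisym restrict extend
      where
      j = i + z ∸ k
      fibre-unique = Unique.filter⁺ (λ v → falses (column v) ≟ z) (level-unique (suc n) k i)
      restrict : length (fibre z top) ≤ length (level n k j)
      restrict = injection-length-≤ rest (fibre z top) (level n k j) fibre-unique into inj
        where
        into : ∀ {y} → y ∈ fibre z top → rest y ∈ level n k j
        into y∈ with fibre-split y∈
        ... | _ , mc , rank≡ = ∈-level⁺ mc (+-cancelˡ-≡ (k ∸ z) _ _ (trans rank≡ (sym (rank-of-rest z k i z≤k k≤i+z))))
        inj : ∀ {x y} → x ∈ fibre z top → y ∈ fibre z top → rest x ≡ rest y → x ≡ y
        inj {x} {y} x∈ y∈ rest≡ = begin
          x                           ≡⟨ sym (attach-split x) ⟩
          attach (column x) (rest x)  ≡⟨ cong₂ attach (trans (proj₁ (fibre-split x∈)) (sym (proj₁ (fibre-split y∈)))) rest≡ ⟩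
          attach (column y) (rest y)  ≡⟨ attach-split y ⟩
          y                           ∎
          where open ≡-Reasoning
      extend : length (level n k j) ≤ length (fibre z top)
      extend = injection-length-≤ (attach (stepColumn z k)) (level n k j) (fibre z top) (level-unique n k j) into inj
        where
        into : ∀ {u} → u ∈ level n k j → attach (stepColumn z k) u ∈ fibre z top
        into {u} u∈ with ∈-level⁻ u∈
        ... | mc , rank≡j = ∈-filter⁺ (λ v → falses (column v) ≟ z)
              (∈-level⁺ (multichain-attach⁺ (stepColumn z k) u (stepColumn-monotone z k) mc)
                (trans (rank-attach (stepColumn z k) u)
                  (trans (cong₂ _+_ (trues-stepColumn z k) rank≡j) (rank-of-rest z k i z≤k k≤i+z))))
              (trans (cong falses (column-attach (stepColumn z k) u)) (falses-stepColumn z≤k))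
        inj : ∀ {u u'} → u ∈ level n k j → u' ∈ level n k j → attach (stepColumn z k) u ≡ attach (stepColumn z k) u' → u ≡ u'
        inj {u} {u'} _ _ eq = trans (sym (rest-attach (stepColumn z k) u))
                                (trans (cong rest eq) (rest-attach (stepColumn z k) u'))

    recurrence : levelSize (suc n) k i ≡ Σ< (suc k) (λ z → shift k (levelSize n k) (i + z))
    recurrence = begin
      length top
        ≡⟨ ≤-antisym (length≤fibreSum (upTo (suc k)) top (λ {y} _ → ∈-upTo⁺ (s≤s (falses≤ (column y)))))
                     (fibreSum≤length (upTo (suc k)) top (Unique.upTo⁺ (suc k))) ⟩
      fibreSum (upTo (suc k)) top
        ≡⟨ sum-map-cong (upTo (suc k)) (λ z∈ → fibre-size _ (≤-pred (∈-upTo⁻ z∈))) ⟩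
      sum (map (λ z → shift k (levelSize n k) (i + z)) (upTo (suc k)))
        ≡⟨ sum-applyUpTo (λ z → shift k (levelSize n k) (i + z)) (λ z → z) (suc k) ⟩
      Σ< (suc k) (λ z → shift k (levelSize n k) (i + z)) ∎
      where open ≡-Reasoning

-- Rank-log-concavity: by induction on n, since B_0[k] is a point and the
-- recurrence only shifts and window-sums, the level sizes are PF₂.
module RankLogConcavity where

  open import Data.Nat using (zero; suc; _*_; _≤_; z≤n)
  open import Data.Nat.Properties using (*-zeroʳ; *-comm; ≤-refl)
  open import Data.Vec using ([]; _∷_)
  open import Data.Product using (_×_; _,_)
  open import Data.Empty using (⊥)
  open import Relation.Binary.PropositionalEquality using (_≡_; refl; sym; trans; subst)
  open Counting using (no-members⇒length≡0)
  open Enumeration using (level; ∈-level⁻; rank-B₀)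
  open LogConcavity
  open LevelRecurrence using (recurrence)

  levelSize-B₀ : ∀ k y → levelSize 0 k (suc y) ≡ 0
  levelSize-B₀ k y = no-members⇒length≡0 (level 0 k (suc y)) λ v∈ → rank-positive (∈-level⁻ v∈)
    where
    rank-positive : ∀ {v : Elem 0 k} → IsMultichain v × rank v ≡ suc y → ⊥
    rank-positive {v} (_ , rank≡) with trans (sym (rank-B₀ v)) rank≡
    ... | ()

  levelSize-PF₂ : ∀ n k → PF₂ (levelSize n k)
  levelSize-PF₂ zero k x y _ rewrite levelSize-B₀ k y | *-zeroʳ (levelSize 0 k x) = z≤n
  levelSize-PF₂ (suc n) k = PF₂-cong (λ i → sym (recurrence n k i))
    (Window.PF₂-window (suc k) (shift k (levelSize n k)) (PF₂-shift k (levelSize n k) (levelSize-PF₂ n k)))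

  rankLogConcave : ∀ n k → RankLogConcave n k
  rankLogConcave n k zero () _
  rankLogConcave n k (suc i) _ _ = subst (_≤ levelSize n k (suc i) * levelSize n k (suc i))
    (*-comm (levelSize n k i) _) (levelSize-PF₂ n k i (suc i) ≤-refl)

-- Since B_n[k] ≅ B_1[k]ⁿ is a
-- product of n chains with k+1 elements, it has one, built by induction on
-- n: a chain x₀ < … < x_L of B_n[k] times the chain 0 < 1 < … < k of
-- columns splits into the min(L,k)+1 "hooks"
--   (x₀,t) < … < (x_{L-t},t) < (x_{L-t},t+1) < … < (x_{L-t},k),
-- which are again symmetric about the middle rank.
module SymmetricChains where

  open import Data.Nat using (zero; suc; _+_; _*_; _∸_; _≤_; _<_; z≤n; _≤?_; _⊓_)
  open import Data.Nat.Properties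
  open import Data.Bool using (b≤b)
  import Data.Bool as Bool
  open import Data.Vec.Relation.Binary.Pointwise.Inductive as Pointwise using ()
  open import Data.Product using (_×_; _,_; proj₁; proj₂)
  open import Data.Empty using (⊥-elim)
  open import Relation.Nullary using (yes; no; ¬_)
  open import Relation.Binary.PropositionalEquality
  open import Data.Nat.Tactic.RingSolver using (solve-∀)
  open Columns
  open Enumeration using (rank-B₀)

  -- Each multichain v lies on the chain with bottom element  base v,  at
  -- position  pos v.  The chain with bottom C is
  --   chain C 0 ≤ chain C 1 ≤ … ≤ chain C (span C),
  -- its p-th element has rank  bottomRank C + p,  and it is symmetric:
  -- it starts as far above rank 0 as it ends below the top rank n·k.
  record SymmetricChainDecomposition (n k : ℕ) : Set where
    field
      base : Elem n k → Elem n k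
      pos : Elem n k → ℕ
      bottomRank : Elem n k → ℕ
      span : Elem n k → ℕ
      chain : Elem n k → ℕ → Elem n k
      base-multichain : ∀ v → IsMultichain v → IsMultichain (base v)
      base-idempotent : ∀ v → IsMultichain v → base (base v) ≡ base v
      pos≤span : ∀ v → IsMultichain v → pos v ≤ span (base v)
      chain-pos : ∀ v → IsMultichain v → chain (base v) (pos v) ≡ v
      chain-multichain : ∀ v → IsMultichain v → ∀ p → p ≤ span (base v) → IsMultichain (chain (base v) p)
      chain-base : ∀ v → IsMultichain v → ∀ p → p ≤ span (base v) → base (chain (base v) p) ≡ base v
      chain-step : ∀ v → IsMultichain v → ∀ p → p < span (base v) → chain (base v) p ≤ₖ chain (base v) (suc p)
      chain-rank : ∀ v → IsMultichain v → ∀ p → p ≤ span (base v) → rank (chain (base v) p) ≡ bottomRank (base v) + p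
      symmetric : ∀ v → IsMultichain v → bottomRank (base v) + span (base v) + bottomRank (base v) ≡ n * k

    pos-chain : ∀ v → IsMultichain v → ∀ p → p ≤ span (base v) → pos (chain (base v) p) ≡ p
    pos-chain v mv p p≤ = +-cancelˡ-≡ (bottomRank (base v)) _ _ (trans (sym rank-via-pos) (chain-rank v mv p p≤))
      where
      w = chain (base v) p
      mw = chain-multichain v mv p p≤
      base-w : base w ≡ base v
      base-w = chain-base v mv p p≤
      rank-via-pos : rank w ≡ bottomRank (base v) + pos w
      rank-via-pos = trans (cong rank (sym (trans (cong (λ c → chain c (pos w)) (sym base-w)) (chain-pos w mw))))
        (chain-rank v mv (pos w) (subst (λ c → pos w ≤ span c) base-w (pos≤span w mw)))

  scd-B₀ : ∀ k → SymmetricChainDecomposition 0 k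
  scd-B₀ k = record
    { base = λ v → v ; pos = λ _ → 0 ; bottomRank = λ _ → 0 ; span = λ _ → 0 ; chain = λ C _ → C
    ; base-multichain = λ _ mv → mv ; base-idempotent = λ _ _ → refl ; pos≤span = λ _ _ → z≤n
    ; chain-pos = λ _ _ → refl ; chain-multichain = λ _ mv _ _ → mv ; chain-base = λ _ _ _ _ → refl
    ; chain-step = λ _ _ _ ()
    ; chain-rank = λ { v _ .zero z≤n → rank-B₀ v }
    ; symmetric = λ _ _ → refl }

  a≤L∸b⇒b≤L∸a : ∀ {a b L} → b ≤ L → a ≤ L ∸ b → b ≤ L ∸ a
  a≤L∸b⇒b≤L∸a {a} {b} {L} b≤L a≤ = m+n≤o⇒m≤o∸n b (subst (_≤ L) (+-comm a b) (m≤o∸n⇒m+n≤o a b≤L a≤))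

  module Step {n k : ℕ} (D : SymmetricChainDecomposition n k) where
    open SymmetricChainDecomposition D

    hookElem : Elem n k → ℕ → ℕ → Elem (suc n) k
    hookElem C t p with p ≤? span C ∸ t
    ... | yes _ = attach (topColumn t k) (chain C p)
    ... | no _ = attach (topColumn (t + (p ∸ (span C ∸ t))) k) (chain C (span C ∸ t))

    hookElem-vertical : ∀ C t p → p ≤ span C ∸ t → hookElem C t p ≡ attach (topColumn t k) (chain C p)
    hookElem-vertical C t p p≤ with p ≤? span C ∸ t
    ... | yes _ = refl
    ... | no p≰ = ⊥-elim (p≰ p≤)

    hookElem-horizontal : ∀ C t p → ¬ p ≤ span C ∸ t →
      hookElem C t p ≡ attach (topColumn (t + (p ∸ (span C ∸ t))) k) (chain C (span C ∸ t))
    hookElem-horizontal C t p p≰ with p ≤? span C ∸ t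
    ... | yes p≤ = ⊥-elim (p≰ p≤)
    ... | no _ = refl

    hookSpan : Elem n k → ℕ → ℕ
    hookSpan C t = (span C ∸ t) + (k ∸ t)

    -- coordinates of v ∈ B_{n+1}[k]: j trues in the column, the rest at
    -- position i on the chain with bottom C of span L; v lies on hook
    -- t = min(j, L - i), at position i + (j - t)
    colTrues : Elem (suc n) k → ℕ
    colTrues v = trues (column v)
    restBase : Elem (suc n) k → Elem n k
    restBase v = base (rest v)
    restPos : Elem (suc n) k → ℕ
    restPos v = pos (rest v)
    hookIndex : Elem (suc n) k → ℕ
    hookIndex v = colTrues v ⊓ (span (restBase v) ∸ restPos v)

    -- the new decomposition: a hook is named by its bottom element, whose
    -- column has t trues, so that t = colTrues of the bottom
    base' : Elem (suc n) k → Elem (suc n) k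
    base' v = attach (topColumn (hookIndex v) k) (chain (restBase v) 0)
    pos' : Elem (suc n) k → ℕ
    pos' v = restPos v + (colTrues v ∸ hookIndex v)
    bottomRank' : Elem (suc n) k → ℕ
    bottomRank' C' = bottomRank (restBase C') + colTrues C'
    span' : Elem (suc n) k → ℕ
    span' C' = hookSpan (restBase C') (colTrues C')
    chain' : Elem (suc n) k → ℕ → Elem (suc n) k
    chain' C' p = hookElem (restBase C') (colTrues C') p

    module OnChain (u : Elem n k) (mu : IsMultichain u) where
      C = base u
      L = span C

      base'-attach : ∀ j p → j ≤ k → p ≤ L →
        base' (attach (topColumn j k) (chain C p)) ≡ attach (topColumn (j ⊓ (L ∸ p)) k) (chain C 0)
      base'-attach j p j≤k p≤L = cong₂ (λ t c → attach (topColumn t k) (chain c 0)) hookIndex≡ restBase≡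
        where
        w = attach (topColumn j k) (chain C p)
        restBase≡ : restBase w ≡ C
        restBase≡ = trans (cong base (rest-attach (topColumn j k) (chain C p))) (chain-base u mu p p≤L)
        hookIndex≡ : hookIndex w ≡ j ⊓ (L ∸ p)
        hookIndex≡ = cong₂ _⊓_ (trans (cong trues (column-attach (topColumn j k) (chain C p))) (trues-topColumn j≤k))
          (cong₂ _∸_ (cong span restBase≡)
            (trans (cong pos (rest-attach (topColumn j k) (chain C p))) (pos-chain u mu p p≤L)))

      module Hook (t : ℕ) (t≤L : t ≤ L) (t≤k : t ≤ k) where
        q = L ∸ t

        q≤L : q ≤ L
        q≤L = m∸n≤m L t

        horizontal-bounds : ∀ p → ¬ p ≤ q → p ≤ hookSpan C t → q ≤ p × t + (p ∸ q) ≤ k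
        horizontal-bounds p p≰q p≤ = q≤p , subst (_≤ k) (+-comm (p ∸ q) t)
          (subst ((p ∸ q) + t ≤_) (m∸n+n≡m t≤k) (+-monoˡ-≤ t (m≤n+o⇒m∸n≤o p q p≤)))
          where q≤p = <⇒≤ (≰⇒> p≰q)

        hook-multichain : ∀ p → p ≤ hookSpan C t → IsMultichain (hookElem C t p)
        hook-multichain p p≤ with p ≤? q
        ... | yes p≤q = multichain-attach⁺ (topColumn t k) (chain C p) (topColumn-monotone t k)
                          (chain-multichain u mu p (≤-trans p≤q q≤L))
        ... | no p≰q = multichain-attach⁺ (topColumn (t + (p ∸ q)) k) (chain C q) (topColumn-monotone (t + (p ∸ q)) k)
                         (chain-multichain u mu q q≤L)

        hook-rank : ∀ p → p ≤ hookSpan C t → rank (hookElem C t p) ≡ (bottomRank C + t) + p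
        hook-rank p p≤ with p ≤? q
        ... | yes p≤q = begin
          rank (attach (topColumn t k) (chain C p))    ≡⟨ rank-attach (topColumn t k) (chain C p) ⟩
          trues (topColumn t k) + rank (chain C p)     ≡⟨ cong₂ _+_ (trues-topColumn t≤k) (chain-rank u mu p (≤-trans p≤q q≤L)) ⟩
          t + (bottomRank C + p)                       ≡⟨ regroup t (bottomRank C) p ⟩
          bottomRank C + t + p                         ∎
          where
          open ≡-Reasoning
          regroup : ∀ a b c → a + (b + c) ≡ b + a + c
          regroup = solve-∀
        ... | no p≰q with horizontal-bounds p p≰q p≤
        ...   | q≤p , t'≤k = begin
          rank (attach (topColumn (t + (p ∸ q)) k) (chain C q))    ≡⟨ rank-attach (topColumn (t + (p ∸ q)) k) (chain C q) ⟩
          trues (topColumn (t + (p ∸ q)) k) + rank (chain C q)     ≡⟨ cong₂ _+_ (trues-topColumn t'≤k) (chain-rank u mu q q≤L) ⟩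
          t + (p ∸ q) + (bottomRank C + q)                        ≡⟨ regroup t (p ∸ q) (bottomRank C) q ⟩
          bottomRank C + t + ((p ∸ q) + q)                        ≡⟨ cong (bottomRank C + t +_) (m∸n+n≡m q≤p) ⟩
          bottomRank C + t + p                                    ∎
          where
          open ≡-Reasoning
          regroup : ∀ a b c d → a + b + (c + d) ≡ c + a + (b + d)
          regroup = solve-∀

        hook-base : ∀ p → p ≤ hookSpan C t → base' (hookElem C t p) ≡ attach (topColumn t k) (chain C 0)
        hook-base p p≤ with p ≤? q
        ... | yes p≤q = trans (base'-attach t p t≤k (≤-trans p≤q q≤L))
          (cong (λ a → attach (topColumn a k) (chain C 0)) (m≤n⇒m⊓n≡m (a≤L∸b⇒b≤L∸a t≤L p≤q)))
        ... | no p≰q with horizontal-bounds p p≰q p≤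
        ...   | q≤p , t'≤k = trans (base'-attach (t + (p ∸ q)) q t'≤k q≤L)
          (cong (λ a → attach (topColumn a k) (chain C 0))
            (trans (cong ((t + (p ∸ q)) ⊓_) (m∸[m∸n]≡n t≤L)) (m≥n⇒m⊓n≡n (m≤m+n t (p ∸ q)))))

        hook-step : ∀ p → p < hookSpan C t → hookElem C t p ≤ₖ hookElem C t (suc p)
        hook-step p p< with suc p ≤? q
        ... | yes sp≤q = subst (λ c → c ≤ₖ attach (topColumn t k) (chain C (suc p)))
          (sym (hookElem-vertical C t p (≤-trans (n≤1+n p) sp≤q)))
          (attach-≤ (Pointwise.refl b≤b) (chain-step u mu p (≤-trans sp≤q q≤L)))
        ... | no sp≰q with p ≤? q
        ...   | yes p≤q =
          subst (λ w → attach (topColumn t k) (chain C w) ≤ₖ attach (topColumn (t + (suc p ∸ q)) k) (chain C q)) (sym p≡q)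
            (attach-≤ (subst (λ w → Pointwise.Pointwise Bool._≤_ (topColumn t k) (topColumn w k)) turn (topColumn-≤ t<k))
                      ≤ₖ-refl)
          where
          p≡q : p ≡ q
          p≡q = ≤-antisym p≤q (≤-pred (≰⇒> sp≰q))
          one-past : suc p ∸ q ≡ 1
          one-past = trans (cong (λ w → suc w ∸ q) p≡q) (trans (+-∸-assoc 1 (≤-refl {q})) (cong suc (n∸n≡0 q)))
          turn : suc t ≡ t + (suc p ∸ q)
          turn = trans (+-comm 1 t) (cong (t +_) (sym one-past))
          t<k : t < k
          t<k = subst (t <_) (m∸n+n≡m t≤k)
            (+-monoˡ-≤ t (+-cancelˡ-≤ q 1 (k ∸ t) (subst (_≤ q + (k ∸ t)) (trans (cong suc p≡q) (+-comm 1 q)) p<)))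
        ...   | no p≰q with horizontal-bounds (suc p) sp≰q p<
        ...     | _ , t'≤k =
          attach-≤ (subst (λ w → Pointwise.Pointwise Bool._≤_ (topColumn (t + (p ∸ q)) k) (topColumn w k)) turn (topColumn-≤ lt))
                   ≤ₖ-refl
          where
          turn : suc (t + (p ∸ q)) ≡ t + (suc p ∸ q)
          turn = trans (sym (+-suc t (p ∸ q))) (cong (t +_) (sym (+-∸-assoc 1 (<⇒≤ (≰⇒> p≰q)))))
          lt : t + (p ∸ q) < k
          lt = subst (_≤ k) (sym turn) t'≤k

    module Decompose (v : Elem (suc n) k) (mv : IsMultichain v) where
      column-monotone×rest-multichain : Monotone (column v) × IsMultichain (rest v)
      column-monotone×rest-multichain = multichain-attach⁻ (column v) (rest v) (subst IsMultichain (sym (attach-split v)) mv)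
      rest-multichain : IsMultichain (rest v)
      rest-multichain = proj₂ column-monotone×rest-multichain
      open OnChain (rest v) rest-multichain public
      j = colTrues v
      i = restPos v
      t = hookIndex v
      j≤k : j ≤ k
      j≤k = trues≤ (column v)
      t≤k : t ≤ k
      t≤k = ≤-trans (m⊓n≤m j (L ∸ i)) j≤k
      t≤L : t ≤ L
      t≤L = ≤-trans (m⊓n≤n j (L ∸ i)) (m∸n≤m L i)
      i≤L : i ≤ L
      i≤L = pos≤span (rest v) rest-multichain
      open Hook t t≤L t≤k public

      v≡ : attach (topColumn j k) (rest v) ≡ v
      v≡ = trans (cong (λ c → attach c (rest v)) (sym (monotone⇒top (column v) (proj₁ column-monotone×rest-multichain))))
             (attach-split v)

      base'≡ : base' v ≡ hookElem C t 0
      base'≡ = sym (hookElem-vertical C t 0 z≤n)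

      restBase-base' : restBase (base' v) ≡ C
      restBase-base' = trans (cong base (rest-attach (topColumn t k) (chain C 0))) (chain-base (rest v) rest-multichain 0 z≤n)
      colTrues-base' : colTrues (base' v) ≡ t
      colTrues-base' = trans (cong trues (column-attach (topColumn t k) (chain C 0))) (trues-topColumn t≤k)
      bottomRank'≡ : bottomRank' (base' v) ≡ bottomRank C + t
      bottomRank'≡ = cong₂ (λ c s → bottomRank c + s) restBase-base' colTrues-base'
      span'≡ : span' (base' v) ≡ hookSpan C t
      span'≡ = cong₂ hookSpan restBase-base' colTrues-base'
      chain'≡ : ∀ p → chain' (base' v) p ≡ hookElem C t p
      chain'≡ p = cong₂ (λ c s → hookElem c s p) restBase-base' colTrues-base'

      located : pos' v ≤ hookSpan C t × hookElem C t (pos' v) ≡ v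
      located with j ≤? L ∸ i
      ... | yes j≤L∸i = pos'≤ , recovered
        where
        t≡j : t ≡ j
        t≡j = m≤n⇒m⊓n≡m j≤L∸i
        pos'≡i : pos' v ≡ i
        pos'≡i = trans (cong (i +_) (trans (cong (j ∸_) t≡j) (n∸n≡0 j))) (+-identityʳ i)
        i≤L∸t : i ≤ L ∸ t
        i≤L∸t = subst (λ w → i ≤ L ∸ w) (sym t≡j) (a≤L∸b⇒b≤L∸a i≤L j≤L∸i)
        pos'≤ : pos' v ≤ hookSpan C t
        pos'≤ = subst (_≤ hookSpan C t) (sym pos'≡i) (≤-trans i≤L∸t (m≤m+n (L ∸ t) (k ∸ t)))
        recovered : hookElem C t (pos' v) ≡ v
        recovered = trans (cong (hookElem C t) pos'≡i) (trans (hookElem-vertical C t i i≤L∸t)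
          (trans (cong₂ (λ a b → attach (topColumn a k) b) t≡j (chain-pos (rest v) rest-multichain)) v≡))
      ... | no j≰L∸i = pos'≤ , recovered
        where
        t≡L∸i : t ≡ L ∸ i
        t≡L∸i = m≥n⇒m⊓n≡n (<⇒≤ (≰⇒> j≰L∸i))
        L∸t≡i : L ∸ t ≡ i
        L∸t≡i = trans (cong (L ∸_) t≡L∸i) (m∸[m∸n]≡n i≤L)
        t<j : t < j
        t<j = subst (_< j) (sym t≡L∸i) (≰⇒> j≰L∸i)
        pos'≤ : pos' v ≤ hookSpan C t
        pos'≤ = +-mono-≤ (≤-reflexive (sym L∸t≡i)) (∸-monoˡ-≤ t j≤k)
        pos'≰ : ¬ pos' v ≤ L ∸ t
        pos'≰ le = <-irrefl refl (≤-trans (subst (_< pos' v) (+-identityʳ i) (+-monoʳ-< i (m<n⇒0<n∸m t<j)))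
                                          (subst (pos' v ≤_) L∸t≡i le))
        excess : pos' v ∸ (L ∸ t) ≡ j ∸ t
        excess = trans (cong (pos' v ∸_) L∸t≡i) (m+n∸m≡n i (j ∸ t))
        recovered : hookElem C t (pos' v) ≡ v
        recovered = trans (hookElem-horizontal C t (pos' v) pos'≰)
          (trans (cong₂ (λ a b → attach (topColumn a k) b) (trans (cong (t +_) excess) (m+[n∸m]≡n (<⇒≤ t<j)))
                   (trans (cong (chain C) L∸t≡i) (chain-pos (rest v) rest-multichain))) v≡)

      -- the hook's ranks run from r + t to (r + L) + (k - t), symmetric since r + L + r = n·k
      symmetric' : bottomRank' (base' v) + span' (base' v) + bottomRank' (base' v) ≡ suc n * k
      symmetric' rewrite bottomRank'≡ | span'≡ = begin
        bottomRank C + t + ((L ∸ t) + (k ∸ t)) + (bottomRank C + t)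
          ≡⟨ regroup (bottomRank C) t (L ∸ t) (k ∸ t) ⟩
        (k ∸ t) + t + (bottomRank C + ((L ∸ t) + t) + bottomRank C)
          ≡⟨ cong₂ (λ a b → a + (bottomRank C + b + bottomRank C)) (m∸n+n≡m t≤k) (m∸n+n≡m t≤L) ⟩
        k + (bottomRank C + L + bottomRank C)
          ≡⟨ cong (k +_) (symmetric (rest v) rest-multichain) ⟩
        k + n * k ∎
        where
        open ≡-Reasoning
        regroup : ∀ r t a b → r + t + (a + b) + (r + t) ≡ b + t + (r + (a + t) + r)
        regroup = solve-∀

    scd-step : SymmetricChainDecomposition (suc n) k
    scd-step = record
      { base = base' ; pos = pos' ; bottomRank = bottomRank' ; span = span' ; chain = chain'
      ; base-multichain = λ v mv → let open Decompose v mv in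
          subst IsMultichain (sym base'≡) (hook-multichain 0 z≤n)
      ; base-idempotent = λ v mv → let open Decompose v mv in
          trans (cong base' base'≡) (hook-base 0 z≤n)
      ; pos≤span = λ v mv → let open Decompose v mv in
          subst (pos' v ≤_) (sym span'≡) (proj₁ located)
      ; chain-pos = λ v mv → let open Decompose v mv in
          trans (chain'≡ (pos' v)) (proj₂ located)
      ; chain-multichain = λ v mv p p≤ → let open Decompose v mv in
          subst IsMultichain (sym (chain'≡ p)) (hook-multichain p (subst (p ≤_) span'≡ p≤))
      ; chain-base = λ v mv p p≤ → let open Decompose v mv in
          trans (cong base' (chain'≡ p)) (hook-base p (subst (p ≤_) span'≡ p≤))
      ; chain-step = λ v mv p p< → let open Decompose v mv in
          subst₂ _≤ₖ_ (sym (chain'≡ p)) (sym (chain'≡ (suc p))) (hook-step p (subst (p <_) span'≡ p<))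
      ; chain-rank = λ v mv p p≤ → let open Decompose v mv in
          trans (cong rank (chain'≡ p)) (trans (hook-rank p (subst (p ≤_) span'≡ p≤)) (cong (_+ p) (sym bottomRank'≡)))
      ; symmetric = λ v mv → Decompose.symmetric' v mv
      }

  scd : ∀ n k → SymmetricChainDecomposition n k
  scd zero k = scd-B₀ k
  scd (suc n) k = Step.scd-step (scd n k)

-- Let S be covered by m antichains and let W be the m' = min(m, nk+1)
-- middle levels.  A symmetric chain either covers all of W or lies inside
-- W, so it meets at least min(m', span + 1) levels of W; and it contains
-- at most min(m, span + 1) elements of S (its elements of S are pairwise
-- comparable, so lie in distinct antichains).  Summing over chains,
-- |S| ≤ Σ_{levels in W} #(chains meeting the level) ≤ Σ_{levels in W}
-- (level size), which is at most the sum of the m largest levels.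
module StrongSpernerProof where

  open import Data.Nat using (zero; suc; _+_; _*_; _∸_; _≤_; _<_; z≤n; s≤s; _≟_; _≤?_; _⊓_; ⌊_/2⌋; ⌈_/2⌉)
  open import Data.Nat.Properties
  open import Data.List using (List; []; _∷_; length; filter; map; upTo; applyUpTo; take; reverse)
  open import Data.List.Properties using (length-map; length-applyUpTo)
  open import Data.Nat.ListAction using (sum)
  open import Data.List.Relation.Unary.Any using (Any; here; there)
  open import Data.List.Membership.Propositional using (_∈_; find)
  open import Data.List.Membership.Propositional.Properties using (∈-filter⁺; ∈-filter⁻; ∈-upTo⁺)
  open import Data.List.Relation.Unary.Unique.Propositional using (Unique)
  import Data.List.Relation.Unary.Unique.Propositional.Properties as Unique
  open import Data.List.Relation.Binary.Sublist.Propositional using (_⊆_; _∷_; _∷ʳ_; minimum)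
  import Data.List.Relation.Binary.Sublist.Propositional.Properties as Sublist
  open import Data.Product using (_×_; _,_; proj₁; proj₂; ∃)
  open import Data.Sum using (_⊎_; inj₁; inj₂)
  open import Data.Empty using (⊥-elim)
  open import Relation.Nullary using (Dec; yes; no)
  open import Relation.Nullary.Decidable using (_×-dec_)
  open import Relation.Binary.Definitions using (DecidableEquality)
  open import Relation.Binary.PropositionalEquality
  open FiniteSums
  open Counting
  open LargestEntries using (sublist-sum≤largest; sum-take-mono)
  open import Data.List.Sort.InsertionSort.Base ≤-decTotalOrder using (sort)
  open Enumeration
  open Columns using (≤ₖ-refl; ≤ₖ-trans)
  open SymmetricChains

  module FirstIndex {E : Set} (_≟_ : DecidableEquality E) where
    open import Data.List.Membership.DecPropositional _≟_ using (_∈?_)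

    firstIndex : List (List E) → E → ℕ
    firstIndex [] x = 0
    firstIndex (A ∷ As) x with x ∈? A
    ... | yes _ = 0
    ... | no _ = suc (firstIndex As x)

    firstIndex< : ∀ As x → Any (x ∈_) As → firstIndex As x < length As
    firstIndex< (A ∷ As) x x∈As with x ∈? A
    ... | yes _ = s≤s z≤n
    firstIndex< (A ∷ As) x (here x∈A) | no x∉A = ⊥-elim (x∉A x∈A)
    firstIndex< (A ∷ As) x (there x∈As) | no _ = s≤s (firstIndex< As x x∈As)

    same-firstIndex : ∀ As x y → Any (x ∈_) As → Any (y ∈_) As → firstIndex As x ≡ firstIndex As y →
                      ∃ λ A → A ∈ As × x ∈ A × y ∈ A
    same-firstIndex (A ∷ As) x y _ _ eq with x ∈? A | y ∈? A
    ... | yes x∈A | yes y∈A = A , here refl , x∈A , y∈A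
    ... | yes _ | no _ with eq
    ...   | ()
    same-firstIndex (A ∷ As) x y _ _ eq | no _ | yes _ with eq
    ...   | ()
    same-firstIndex (A ∷ As) x y (here x∈A) _ eq | no x∉A | no _ = ⊥-elim (x∉A x∈A)
    same-firstIndex (A ∷ As) x y (there _) (here y∈A) eq | no _ | no y∉A = ⊥-elim (y∉A y∈A)
    same-firstIndex (A ∷ As) x y (there x∈As) (there y∈As) eq | no _ | no _
      with same-firstIndex As x y x∈As y∈As (suc-injective eq)
    ... | B , B∈ , x∈B , y∈B = B , there B∈ , x∈B , y∈B

  module MiddleWindow (M m' : ℕ) (m'≤M : m' ≤ M) where
    c = ⌊ M ∸ m' /2⌋

    fits : c + c + m' ≤ M
    fits = m≤o∸n⇒m+n≤o (c + c) m'≤M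
      (≤-trans (+-monoʳ-≤ c (⌊n/2⌋≤⌈n/2⌉ (M ∸ m'))) (≤-reflexive (⌊n/2⌋+⌈n/2⌉≡n (M ∸ m'))))

    centred : M ≤ suc (c + c + m')
    centred = begin
      M                              ≡⟨ sym (m∸n+n≡m m'≤M) ⟩
      (M ∸ m') + m'                  ≡⟨ cong (_+ m') (sym (⌊n/2⌋+⌈n/2⌉≡n (M ∸ m'))) ⟩
      c + ⌈ M ∸ m' /2⌉ + m'          ≤⟨ +-monoˡ-≤ m' (+-monoʳ-≤ c (⌊n/2⌋-mono (n≤1+n (suc (M ∸ m'))))) ⟩
      c + suc c + m'                 ≡⟨ cong (_+ m') (+-suc c c) ⟩
      suc (c + c + m')               ∎
      where open ≤-Reasoning

  consecutive-⊆ : ∀ (g : ℕ → ℕ) c m M → c + m ≤ M → applyUpTo (λ i → g (c + i)) m ⊆ applyUpTo g M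
  consecutive-⊆ g zero zero M _ = minimum _
  consecutive-⊆ g zero (suc m) (suc M) (s≤s m≤M) = refl ∷ consecutive-⊆ (λ i → g (suc i)) zero m M m≤M
  consecutive-⊆ g (suc c) m (suc M) (s≤s c+m≤M) = g 0 ∷ʳ consecutive-⊆ (λ i → g (suc i)) c m M c+m≤M

  module _ (n k : ℕ) where
    open SymmetricChainDecomposition (scd n k)

    N = n * k

    chain-monotone : ∀ v → IsMultichain v → ∀ {p p'} → p ≤ p' → p' ≤ span (base v) → chain (base v) p ≤ₖ chain (base v) p'
    chain-monotone v mv {p} {zero} z≤n _ = ≤ₖ-refl
    chain-monotone v mv {p} {suc p'} p≤ p'<span with p ≟ suc p'
    ... | yes refl = ≤ₖ-refl
    ... | no p≢ = ≤ₖ-trans (chain-monotone v mv (≤-pred (≤∧≢⇒< p≤ p≢)) (<⇒≤ p'<span)) (chain-step v mv p' p'<span)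

    -- one bottom element per chain
    bottoms : List (Elem n k)
    bottoms = filter (λ v → base v ≟E v) (allMultichains n k)

    bottoms-unique : Unique bottoms
    bottoms-unique = Unique.filter⁺ (λ v → base v ≟E v) (allMultichains-unique n k)

    ∈-bottoms⁻ : ∀ {C} → C ∈ bottoms → IsMultichain C × base C ≡ C
    ∈-bottoms⁻ C∈ with ∈-filter⁻ (λ v → base v ≟E v) {xs = allMultichains n k} C∈
    ... | C∈' , base≡ = ∈-allMultichains⁻ C∈' , base≡

    ∈-bottoms⁺ : ∀ {v} → IsMultichain v → base v ∈ bottoms
    ∈-bottoms⁺ {v} mv = ∈-filter⁺ (λ v → base v ≟E v) (∈-allMultichains⁺ (base-multichain v mv)) (base-idempotent v mv)

    module AtBottom {C : Elem n k} (C∈ : C ∈ bottoms) where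
      mC = proj₁ (∈-bottoms⁻ C∈)
      base≡ = proj₂ (∈-bottoms⁻ C∈)
      chain-multichain' : ∀ p → p ≤ span C → IsMultichain (chain C p)
      chain-multichain' p p≤ = subst (λ c → IsMultichain (chain c p)) base≡ (chain-multichain C mC p (subst (λ c → p ≤ span c) (sym base≡) p≤))
      chain-base' : ∀ p → p ≤ span C → base (chain C p) ≡ C
      chain-base' p p≤ = subst (λ c → base (chain c p) ≡ c) base≡ (chain-base C mC p (subst (λ c → p ≤ span c) (sym base≡) p≤))
      chain-rank' : ∀ p → p ≤ span C → rank (chain C p) ≡ bottomRank C + p
      chain-rank' p p≤ = subst (λ c → rank (chain c p) ≡ bottomRank c + p) base≡ (chain-rank C mC p (subst (λ c → p ≤ span c) (sym base≡) p≤))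
      symmetric' : bottomRank C + span C + bottomRank C ≡ N
      symmetric' = subst (λ c → bottomRank c + span c + bottomRank c ≡ N) base≡ (symmetric C mC)

    meets? : ∀ C j → Dec (bottomRank C ≤ j × j ≤ bottomRank C + span C)
    meets? C j = (bottomRank C ≤? j) ×-dec (j ≤? bottomRank C + span C)

    -- distinct chains meet a level in distinct elements
    chains-meeting≤levelSize : ∀ j → sum (map (λ C → 𝟙 (meets? C j)) bottoms) ≤ levelSize n k j
    chains-meeting≤levelSize j = subst (_≤ levelSize n k j) (sym (sum-𝟙≡count (λ C → meets? C j) bottoms))
      (injection-length-≤ element (filter (λ C → meets? C j) bottoms) (level n k j)
        (Unique.filter⁺ (λ C → meets? C j) bottoms-unique) into inj)
      where
      element : Elem n k → Elem n k
      element C = chain C (j ∸ bottomRank C)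
      meeting⁻ : ∀ {C} → C ∈ filter (λ C → meets? C j) bottoms → C ∈ bottoms × j ∸ bottomRank C ≤ span C × bottomRank C ≤ j
      meeting⁻ C∈ with ∈-filter⁻ (λ C → meets? C j) {xs = bottoms} C∈
      ... | C∈' , (r≤j , j≤) = C∈' , m≤n+o⇒m∸n≤o j _ j≤ , r≤j
      into : ∀ {C} → C ∈ filter (λ C → meets? C j) bottoms → element C ∈ level n k j
      into C∈ with meeting⁻ C∈
      ... | C∈' , p≤ , r≤j = ∈-level⁺ (AtBottom.chain-multichain' C∈' _ p≤) (trans (AtBottom.chain-rank' C∈' _ p≤) (m+[n∸m]≡n r≤j))
      inj : ∀ {C C'} → C ∈ filter (λ C → meets? C j) bottoms → C' ∈ filter (λ C → meets? C j) bottoms → element C ≡ element C' → C ≡ C'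
      inj C∈ C'∈ eq with meeting⁻ C∈ | meeting⁻ C'∈
      ... | C∈' , p≤ , _ | C'∈' , p'≤ , _ = trans (sym (AtBottom.chain-base' C∈' _ p≤)) (trans (cong base eq) (AtBottom.chain-base' C'∈' _ p'≤))

    module _ (m : ℕ) (As : List (List (Elem n k))) (length-As : length As ≡ m)
             (antichains : ∀ {A} → A ∈ As → IsAntichain A)
             (S : List (Elem n k)) (S-unique : Unique S) (S-covered : ∀ {x} → x ∈ S → InUnion As x) where

      S-multichain : ∀ {x} → x ∈ S → IsMultichain x
      S-multichain x∈ with find (S-covered x∈)
      ... | A , A∈ , x∈A = proj₁ (antichains A∈) x∈A

      open Fibres _≟E_ base

      M = suc N
      m' = m ⊓ M
      open MiddleWindow M m' (m⊓n≤n m M)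

      windowMeets : Elem n k → ℕ
      windowMeets C = Σ< m' (λ i → 𝟙 (meets? C (c + i)))

      -- a symmetric chain either covers the whole window or lies inside it
      window-met : ∀ {C} → C ∈ bottoms → m' ⊓ suc (span C) ≤ windowMeets C
      window-met {C} C∈ with bottomRank C ≤? c
      ... | yes r≤c = ≤-trans (m⊓n≤m m' _) (≤-reflexive (sym all-met))
        where
        open AtBottom C∈
        r = bottomRank C
        ℓ = span C
        covers : c + m' ≤ suc (r + ℓ)
        covers = +-cancelʳ-≤ r (c + m') (suc (r + ℓ)) (begin
          c + m' + r      ≤⟨ +-monoʳ-≤ (c + m') r≤c ⟩
          c + m' + c      ≡⟨ trans (+-assoc c m' c) (trans (cong (c +_) (+-comm m' c)) (sym (+-assoc c c m'))) ⟩
          c + c + m'      ≤⟨ fits ⟩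
          suc N           ≡⟨ cong suc (sym symmetric') ⟩
          suc (r + ℓ) + r ∎)
          where open ≤-Reasoning
        all-met : windowMeets C ≡ m'
        all-met = trans (Σ<-cong m' (λ i i<m' → 𝟙-true (meets? C (c + i))
                          (≤-trans r≤c (m≤m+n c i) , ≤-pred (≤-trans (+-monoʳ-< c i<m') covers))))
                        (Σ<-one m')
      ... | no r≰c = ≤-trans (m⊓n≤n m' _) (begin
          suc ℓ                                       ≡⟨ sym (trans (Σ<-cong (suc ℓ) (λ p p≤ℓ → 𝟙-true (meets? C (c + (a + p))) (level-on-chain p (≤-pred p≤ℓ)))) (Σ<-one (suc ℓ))) ⟩
          Σ< (suc ℓ) (λ p → met (a + p))              ≤⟨ m≤n+m _ (Σ< a met) ⟩
          Σ< a met + Σ< (suc ℓ) (λ p → met (a + p))   ≡⟨ sym (Σ<-split a (suc ℓ) met) ⟩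
          Σ< (a + suc ℓ) met                          ≤⟨ Σ<-mono-length met inside ⟩
          windowMeets C                               ∎)
        where
        open AtBottom C∈
        open ≤-Reasoning
        r = bottomRank C
        ℓ = span C
        met : ℕ → ℕ
        met i = 𝟙 (meets? C (c + i))
        c<r : c < r
        c<r = ≰⇒> r≰c
        a = r ∸ c
        c+a≡r : c + a ≡ r
        c+a≡r = m+[n∸m]≡n (<⇒≤ c<r)
        level-on-chain : ∀ p → p ≤ ℓ → r ≤ c + (a + p) × c + (a + p) ≤ r + ℓ
        level-on-chain p p≤ℓ = subst (λ w → r ≤ w × w ≤ r + ℓ) (trans (cong (_+ p) (sym c+a≡r)) (+-assoc c a p))
                                 (m≤m+n r p , +-monoʳ-≤ r p≤ℓ)
        top-inside : suc (r + ℓ) ≤ c + m'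
        top-inside = +-cancelʳ-≤ c (suc (r + ℓ)) (c + m') (begin
          suc (r + ℓ) + c ≡⟨ sym (+-suc (r + ℓ) c) ⟩
          r + ℓ + suc c   ≤⟨ +-monoʳ-≤ (r + ℓ) c<r ⟩
          r + ℓ + r       ≡⟨ symmetric' ⟩
          N               ≤⟨ ≤-pred centred ⟩
          c + c + m'      ≡⟨ trans (+-assoc c c m') (trans (cong (c +_) (+-comm c m')) (sym (+-assoc c m' c))) ⟩
          c + m' + c      ∎)
        inside : a + suc ℓ ≤ m'
        inside = +-cancelˡ-≤ c (a + suc ℓ) m' (subst (_≤ c + m') (sym (trans (sym (+-assoc c a (suc ℓ)))
                   (trans (cong (_+ suc ℓ) c+a≡r) (+-suc r ℓ)))) top-inside)

      module OnChainOf {C : Elem n k} (C∈ : C ∈ bottoms) where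
        open AtBottom C∈
        P = fibre C S

        P-unique : Unique P
        P-unique = Unique.filter⁺ (λ y → base y ≟E C) S-unique

        ∈P⁻ : ∀ {x} → x ∈ P → x ∈ S × base x ≡ C
        ∈P⁻ x∈ = ∈-filter⁻ (λ y → base y ≟E C) {xs = S} x∈

        -- distinct elements of a chain have distinct positions
        P≤span+1 : length P ≤ suc (span C)
        P≤span+1 = subst (length P ≤_) (length-applyUpTo (λ i → i) (suc (span C)))
          (injection-length-≤ pos P (upTo (suc (span C))) P-unique into inj)
          where
          into : ∀ {x} → x ∈ P → pos x ∈ upTo (suc (span C))
          into {x} x∈ with ∈P⁻ x∈
          ... | x∈S , base≡ = ∈-upTo⁺ (s≤s (subst (λ c → pos x ≤ span c) base≡ (pos≤span x (S-multichain x∈S))))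
          inj : ∀ {x y} → x ∈ P → y ∈ P → pos x ≡ pos y → x ≡ y
          inj {x} {y} x∈ y∈ eq with ∈P⁻ x∈ | ∈P⁻ y∈
          ... | x∈S , bx | y∈S , by = trans (sym (chain-pos x (S-multichain x∈S)))
                (trans (cong₂ chain (trans bx (sym by)) eq) (chain-pos y (S-multichain y∈S)))

        comparable : ∀ {x y} → x ∈ P → y ∈ P → Comparable x y
        comparable {x} {y} x∈ y∈ = by-positions (≤-total (pos x) (pos y))
          where
          mx = S-multichain (proj₁ (∈P⁻ x∈))
          my = S-multichain (proj₁ (∈P⁻ y∈))
          base-y≡x : base y ≡ base x
          base-y≡x = trans (proj₂ (∈P⁻ y∈)) (sym (proj₂ (∈P⁻ x∈)))
          y-on-chain : chain (base x) (pos y) ≡ y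
          y-on-chain = trans (cong (λ c → chain c (pos y)) (sym base-y≡x)) (chain-pos y my)
          py≤ : pos y ≤ span (base x)
          py≤ = subst (λ c → pos y ≤ span c) base-y≡x (pos≤span y my)
          by-positions : pos x ≤ pos y ⊎ pos y ≤ pos x → Comparable x y
          by-positions (inj₁ le) = inj₁ (subst₂ _≤ₖ_ (chain-pos x mx) y-on-chain (chain-monotone x mx le py≤))
          by-positions (inj₂ le) = inj₂ (subst₂ _≤ₖ_ y-on-chain (chain-pos x mx) (chain-monotone x mx le (pos≤span x mx)))

        -- comparable elements lie in distinct antichains
        P≤m : length P ≤ m
        P≤m = subst (length P ≤_) (length-applyUpTo (λ i → i) m)
          (injection-length-≤ (firstIndex As) P (upTo m) P-unique into inj)
          where
          open FirstIndex _≟E_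
          into : ∀ {x} → x ∈ P → firstIndex As x ∈ upTo m
          into {x} x∈ = ∈-upTo⁺ (subst (firstIndex As x <_) length-As (firstIndex< As x (S-covered (proj₁ (∈P⁻ x∈)))))
          inj : ∀ {x y} → x ∈ P → y ∈ P → firstIndex As x ≡ firstIndex As y → x ≡ y
          inj {x} {y} x∈ y∈ eq with x ≟E y
          ... | yes x≡y = x≡y
          ... | no x≢y with same-firstIndex As x y (S-covered (proj₁ (∈P⁻ x∈))) (S-covered (proj₁ (∈P⁻ y∈))) eq
          ...   | A , A∈ , x∈A , y∈A = ⊥-elim (proj₂ (antichains A∈) x∈A y∈A x≢y (comparable x∈ y∈))

        span≤N : span C ≤ N
        span≤N = subst (span C ≤_) symmetric' (≤-trans (m≤n+m (span C) (bottomRank C)) (m≤m+n _ (bottomRank C)))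

        P≤windowMeets : length P ≤ windowMeets C
        P≤windowMeets = ≤-trans (⊓-glb (⊓-glb P≤m (≤-trans P≤span+1 (s≤s span≤N))) P≤span+1) (window-met C∈)

      S≤window : length S ≤ sum (map (levelSize n k) (applyUpTo (c +_) m'))
      S≤window = begin
        length S                                                 ≤⟨ length≤fibreSum bottoms S (λ x∈ → ∈-bottoms⁺ (S-multichain x∈)) ⟩
        fibreSum bottoms S                                       ≤⟨ sum-map-mono bottoms (λ C∈ → OnChainOf.P≤windowMeets C∈) ⟩
        sum (map windowMeets bottoms)                            ≡⟨ sum-Σ<-swap bottoms m' (λ C i → 𝟙 (meets? C (c + i))) ⟩
        Σ< m' (λ i → sum (map (λ C → 𝟙 (meets? C (c + i))) bottoms)) ≤⟨ Σ<-mono m' (λ i _ → chains-meeting≤levelSize (c + i)) ⟩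
        Σ< m' (λ i → levelSize n k (c + i))                      ≡⟨ sym (sum-applyUpTo (levelSize n k) (c +_) m') ⟩
        sum (map (levelSize n k) (applyUpTo (c +_) m'))          ∎
        where open ≤-Reasoning

      m-Sperner : length S ≤ sumLargestLevels n k m
      m-Sperner = begin
        length S                                    ≤⟨ S≤window ⟩
        sum window                                  ≤⟨ sublist-sum≤largest (levelSizes n k) window window⊆levels ⟩
        sum (take (length window) largestFirst)     ≡⟨ cong (λ w → sum (take w largestFirst)) length-window ⟩
        sum (take m' largestFirst)                  ≤⟨ sum-take-mono largestFirst (m⊓n≤m m M) ⟩
        sumLargestLevels n k m                      ∎
        where
        open ≤-Reasoning
        window = map (levelSize n k) (applyUpTo (c +_) m')
        largestFirst = reverse (sort (levelSizes n k))
        window⊆levels : window ⊆ levelSizes n k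
        window⊆levels = Sublist.map⁺ (levelSize n k)
          (consecutive-⊆ (λ i → i) c m' M (≤-trans (m≤n+m (c + m') c) (≤-trans (≤-reflexive (sym (+-assoc c c m'))) fits)))
        length-window : length window ≡ m'
        length-window = trans (length-map (levelSize n k) (applyUpTo (c +_) m')) (length-applyUpTo (c +_) m')

  strongSperner : ∀ n k → StrongSperner n k
  strongSperner n k m As length-As antichains S S-unique S-covered =
    m-Sperner n k m As length-As antichains S S-unique S-covered

theorem2p10 : (n k : ℕ) → RankLogConcave n k × StrongSperner n k
theorem2p10 n k = RankLogConcavity.rankLogConcave n k , StrongSpernerProof.strongSperner n k
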